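{- Let $n$ be a non-negative integer and let $p$ be an odd prime. Let $C$ be an integer such that $p\nmid C(C^2-4)$. Let $\epsilon=\left(\frac{C^2-4}{p}\right)$ (Legendre symbol) and $d=\gcd(n,p-\epsilon)$. Then the following are equivalent: (i) there exists $x\in\mathbb{Z}$ such that $V_n(x,1)\equiv C \pmod p$; (ii) $p$ divides $U_{(p-\epsilon)/d}(C+2,C+2)$.
   Context: For integers (or elements of a commutative ring) $P,Q$, the Lucas sequences $U_n(P,Q)$ and $V_n(P,Q)$, $n\ge 0$, are defined by $U_0=0$, $U_1=1$, $U_{n+2}=PU_{n+1}-QU_n$ and $V_0=2$, $V_1=P$, $V_{n+2}=PV_{n+1}-QV_n$. Equivalently, if $\alpha,\beta$ are the roots of $x^2-Px+Q=0$ and $\alpha\neq\beta$, then $U_n=(\alpha^n-\beta^n)/(\alpha-\beta)$ and $V_n=\alpha^n+\beta^n$. In particular $V_n(X,1)$ is a polynomial in $X$ of degree $n$ (the Vieta–Lucas polynomial). -}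

module Defs where

open import Data.Nat as ℕ using (ℕ; zero; suc)
open import Data.Integer using (ℤ; +_; _-_; _*_; 0ℤ; 1ℤ; -1ℤ)
open import Data.Integer.Divisibility.Signed using (_∣_; _∣?_)
open import Data.List using (map; upTo)
open import Data.List.Relation.Unary.Any using (any?)
open import Relation.Nullary using (yes; no)

U : ℕ → ℤ → ℤ → ℤ
U zero          P Q = 0ℤ
U (suc zero)    P Q = 1ℤ
U (suc (suc n)) P Q = P * U (suc n) P Q - Q * U n P Q

V : ℕ → ℤ → ℤ → ℤ
V zero          P Q = + 2
V (suc zero)    P Q = P
V (suc (suc n)) P Q = P * V (suc n) P Q - Q * V n P Q

legendre : ℤ → ℕ → ℤ
legendre a p with + p ∣? a
... | yes _ = 0ℤ
... | no  _ with any? (λ x → + p ∣? (x * x - a)) (map +_ (upTo p))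
...   | yes _ = 1ℤ
...   | no  _ = -1ℤ

{-# OPTIONS --safe #-}
-- Let p = 2h + 1 and D = C² − 4, and work in ℤₚ[√D]. Since Vₙ(α + ᾱ, 1) = αⁿ + ᾱⁿ for α of norm 1, and
-- β = (C + √D)/2 has norm 1 and trace C, (i) says that β (or β̄) is an n-th power in the group T of norm-one
-- elements. By Euler's criterion Dʰ = ε, so Frobenius acts on ℤₚ[√D] as the identity or as conjugation and T
-- has exponent m = p − ε; a list of m distinct elements of T (from the parametrisation (a + √D)/(a − √D))
-- together with the root bound for polynomials makes T behave like a cyclic group of order m: γ ∈ T is an
-- n-th power iff γ^(m/d) = 1. Finally r = 1 + β and s = 1 + β̄ satisfy r + s = rs = C + 2, so
-- (r − s) U_k(C + 2, C + 2) = rᵏ − sᵏ = rᵏ(1 − β̄ᵏ), which vanishes iff βᵏ = 1. For (i) ⇒ (ii) the same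
-- argument runs in ℤₚ[√(x² − 4)], whose discriminant differs from C² − 4 by a nonzero square factor.

module Submission where

open import Algebra.Bundles using (CommutativeRing)
import Algebra.Properties.Ring as RingProperties
import Algebra.Solver.Ring as RingSolver
open import Algebra.Solver.Ring.AlmostCommutativeRing using (fromCommutativeRing; _-Raw-AlmostCommutative⟶_)
open import Data.Integer as ℤ using (ℤ; +_; -[1+_]; +0; +[1+_]; 0ℤ; 1ℤ; -1ℤ)
import Data.Integer.DivMod as ℤ
import Data.Integer.Divisibility.Signed as ℤ
import Data.Integer.Properties as ℤ
open import Data.Integer.Tactic.RingSolver using (solve-∀)
import Data.Fin as Fin
import Data.Fin.Properties as Fin
open import Data.List using (List; []; _∷_; length; replicate; _++_; downFrom; map; upTo; filter)
open import Data.List.Membership.Propositional.Properties using (∈-map⁺; ∈-upTo⁺)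
open import Data.List.Properties using (length-++; length-replicate; ++-identityʳ; length-map; length-applyDownFrom; length-downFrom)
open import Data.List.Relation.Unary.All as All using (All; []; _∷_; lookupAny)
import Data.List.Relation.Unary.All.Properties as All
open import Data.List.Relation.Unary.All.Properties using (¬Any⇒All¬)
open import Data.List.Relation.Unary.AllPairs using (AllPairs; []; _∷_)
import Data.List.Relation.Unary.AllPairs.Properties as AllPairs
open import Data.List.Relation.Unary.Any as Any using (any?)
open import Data.Maybe using (Maybe; just; nothing)
open import Data.Nat as ℕ using (ℕ; zero; suc)
import Data.Nat.Combinatorics as ℕ
import Data.Nat.Divisibility as ℕ
open import Data.Nat.GCD using (gcd; gcd-GCD; gcd[m,n]∣m; module Bézout)
open import Data.Nat.Primality using (Prime; euclidsLemma; prime⇒nonZero; prime⇒nonTrivial; prime⇒irreducible; ¬prime[1])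
import Data.Nat.Properties as ℕ
import Data.Nat.Tactic.RingSolver as ℕ-Solver
open import Data.Product as Product using (_,_; ∃-syntax; proj₁; proj₂)
open import Data.Sign as Sign using (Sign)
open import Data.Sum as Sum using (_⊎_; inj₁; inj₂)
open import Defs using (U; V; legendre)
open import Function using (_∘_; id)
open import Function.Bundles using (_⇔_; mk⇔; Equivalence)
open import Level using (0ℓ; _⊔_)
open import Relation.Binary.Definitions using (Decidable)
import Relation.Binary.PropositionalEquality as ≡
open ≡ using (_≡_; _≢_)
open import Relation.Binary.Structures using (IsEquivalence)
open import Relation.Nullary using (¬_; yes; no; contradiction)
import Relation.Nullary.Decidable as Dec
open import Relation.Nullary.Decidable using (¬?)
import Relation.Unary as U
open import Relation.Unary.Properties using (∁?)

length-filter+length-filter-∁ : ∀ {a q} {A : Set a} {P : A → Set q} (P? : U.Decidable P) xs →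
                                length (filter P? xs) ℕ.+ length (filter (∁? P?) xs) ≡ length xs
length-filter+length-filter-∁ P? []       = ≡.refl
length-filter+length-filter-∁ P? (x ∷ xs) with P? x
... | yes _ = ≡.cong suc (length-filter+length-filter-∁ P? xs)
... | no  _ = ≡.trans (ℕ.+-suc _ _) (≡.cong suc (length-filter+length-filter-∁ P? xs))

AllPairs-zipWithAll : ∀ {a q r s} {A : Set a} {P : A → Set q} {R : A → A → Set r} {S : A → A → Set s} →
                      (∀ {x y} → P x → P y → R x y → S x y) → ∀ {xs} → All P xs → AllPairs R xs → AllPairs S xs
AllPairs-zipWithAll f []         []            = []
AllPairs-zipWithAll f (px ∷ pxs) (rx ∷ rxs) = All.zipWith (λ (py , rxy) → f px py rxy) (pxs , rx) ∷ AllPairs-zipWithAll f pxs rxs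

module FromInteger {c ℓ} (R : CommutativeRing c ℓ) where

  open CommutativeRing R
  open RingProperties ring using (-0#≈0#; -‿involutive; -‿distribˡ-*; -‿distribʳ-*; -‿+-comm)
  open import Algebra.Properties.Semiring.Mult.TCOptimised semiring using (_×_; ×-homo-+; ×1-homo-*; 1+×)
  open import Relation.Binary.Reasoning.Setoid setoid

  -- The tail-recursion-optimised _×_ has 1 × x = x definitionally, which the ring solver needs for con 1ℤ.
  fromℤ : ℤ → Carrier
  fromℤ (+ n)      = n × 1#
  fromℤ -[1+ n ]   = - (suc n × 1#)

  fromℤ-neg : ∀ i → fromℤ (ℤ.- i) ≈ - fromℤ i
  fromℤ-neg +0       = sym -0#≈0#
  fromℤ-neg +[1+ n ] = refl
  fromℤ-neg -[1+ n ] = sym (-‿involutive _)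

  private
    signed : Sign → Carrier → Carrier
    signed Sign.+ x = x
    signed Sign.- x = - x

    signed-cong : ∀ s {x y} → x ≈ y → signed s x ≈ signed s y
    signed-cong Sign.+ x≈y = x≈y
    signed-cong Sign.- x≈y = -‿cong x≈y

    fromℤ-signed : ∀ i → fromℤ i ≡ signed (ℤ.sign i) (ℤ.∣ i ∣ × 1#)
    fromℤ-signed (+ n)    = ≡.refl
    fromℤ-signed -[1+ n ] = ≡.refl

    fromℤ-◃ : ∀ s n → fromℤ (s ℤ.◃ n) ≈ signed s (n × 1#)
    fromℤ-◃ Sign.+ zero    = refl
    fromℤ-◃ Sign.+ (suc n) = refl
    fromℤ-◃ Sign.- zero    = sym -0#≈0#
    fromℤ-◃ Sign.- (suc n) = refl

    signed-* : ∀ s t x y → signed (s Sign.* t) (x * y) ≈ signed s x * signed t y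
    signed-* Sign.+ Sign.+ x y = refl
    signed-* Sign.+ Sign.- x y = -‿distribʳ-* x y
    signed-* Sign.- Sign.+ x y = -‿distribˡ-* x y
    signed-* Sign.- Sign.- x y = trans (sym (-‿involutive _)) (trans (-‿cong (-‿distribˡ-* x y)) (-‿distribʳ-* (- x) y))

    fromℤ-⊖ : ∀ m n → fromℤ (m ℤ.⊖ n) ≈ m × 1# - n × 1#
    fromℤ-⊖ zero    zero    = sym (-‿inverseʳ 0#)
    fromℤ-⊖ zero    (suc n) = sym (+-identityˡ _)
    fromℤ-⊖ (suc m) zero    = sym (trans (+-congˡ -0#≈0#) (+-identityʳ _))
    fromℤ-⊖ (suc m) (suc n) = begin
      fromℤ (suc m ℤ.⊖ suc n)              ≡⟨ ≡.cong fromℤ (ℤ.[1+m]⊖[1+n]≡m⊖n m n) ⟩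
      fromℤ (m ℤ.⊖ n)                      ≈⟨ fromℤ-⊖ m n ⟩
      m × 1# - n × 1#                      ≈⟨ +-congʳ (+-identityˡ _) ⟨
      0# + m × 1# - n × 1#                 ≈⟨ +-congʳ (+-congʳ (-‿inverseʳ 1#)) ⟨
      (1# - 1#) + m × 1# - n × 1#          ≈⟨ +-congʳ (+-assoc 1# (- 1#) _) ⟩
      1# + (- 1# + m × 1#) - n × 1#        ≈⟨ +-congʳ (+-congˡ (+-comm (- 1#) _)) ⟩
      1# + (m × 1# - 1#) - n × 1#          ≈⟨ +-congʳ (+-assoc 1# _ (- 1#)) ⟨
      (1# + m × 1#) - 1# - n × 1#          ≈⟨ +-assoc (1# + m × 1#) (- 1#) _ ⟩
      (1# + m × 1#) + (- 1# - n × 1#)      ≈⟨ +-congˡ (-‿+-comm 1# _) ⟩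
      (1# + m × 1#) - (1# + n × 1#)        ≈⟨ +-cong (1+× m 1#) (-‿cong (1+× n 1#)) ⟨
      suc m × 1# - suc n × 1#              ∎

  fromℤ-+ : ∀ i j → fromℤ (i ℤ.+ j) ≈ fromℤ i + fromℤ j
  fromℤ-+ (+ m)    (+ n)    = ×-homo-+ 1# m n
  fromℤ-+ (+ m)    -[1+ n ] = fromℤ-⊖ m (suc n)
  fromℤ-+ -[1+ m ] (+ n)    = trans (fromℤ-⊖ n (suc m)) (+-comm _ _)
  fromℤ-+ -[1+ m ] -[1+ n ] = begin
    - (suc (suc (m ℕ.+ n)) × 1#)           ≡⟨ ≡.cong (λ k → - (suc k × 1#)) (ℕ.+-suc m n) ⟨
    - ((suc m ℕ.+ suc n) × 1#)             ≈⟨ -‿cong (×-homo-+ 1# (suc m) (suc n)) ⟩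
    - (suc m × 1# + suc n × 1#)            ≈⟨ -‿+-comm _ _ ⟨
    - (suc m × 1#) + - (suc n × 1#)        ∎

  fromℤ-* : ∀ i j → fromℤ (i ℤ.* j) ≈ fromℤ i * fromℤ j
  fromℤ-* i j = begin
    fromℤ (i ℤ.* j)                                             ≈⟨ fromℤ-◃ (ℤ.sign i Sign.* ℤ.sign j) (ℤ.∣ i ∣ ℕ.* ℤ.∣ j ∣) ⟩
    signed (ℤ.sign i Sign.* ℤ.sign j) ((ℤ.∣ i ∣ ℕ.* ℤ.∣ j ∣) × 1#) ≈⟨ signed-cong (ℤ.sign i Sign.* ℤ.sign j) (×1-homo-* ℤ.∣ i ∣ ℤ.∣ j ∣) ⟩
    signed (ℤ.sign i Sign.* ℤ.sign j) (ℤ.∣ i ∣ × 1# * ℤ.∣ j ∣ × 1#) ≈⟨ signed-* (ℤ.sign i) (ℤ.sign j) _ _ ⟩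
    signed (ℤ.sign i) (ℤ.∣ i ∣ × 1#) * signed (ℤ.sign j) (ℤ.∣ j ∣ × 1#) ≡⟨ ≡.cong₂ _*_ (fromℤ-signed i) (fromℤ-signed j) ⟨
    fromℤ i * fromℤ j                                           ∎

module IntegerCoefficientSolver {c ℓ} (R : CommutativeRing c ℓ) where

  open CommutativeRing R
  open FromInteger R

  private
    fromℤ-morphism : ℤ.+-*-rawRing -Raw-AlmostCommutative⟶ fromCommutativeRing R
    fromℤ-morphism = record
      { ⟦_⟧    = fromℤ
      ; +-homo = fromℤ-+
      ; *-homo = fromℤ-*
      ; -‿homo = fromℤ-neg
      ; 0-homo = refl
      ; 1-homo = refl
      }

    fromℤ-≟ : ∀ i j → Maybe (fromℤ i ≈ fromℤ j)
    fromℤ-≟ i j with i ℤ.≟ j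
    ... | yes ≡.refl = just refl
    ... | no _       = nothing

  open RingSolver ℤ.+-*-rawRing (fromCommutativeRing R) fromℤ-morphism fromℤ-≟ public


module ExpAndCancellation {c ℓ} (R : CommutativeRing c ℓ) where

  open CommutativeRing R
  open IntegerCoefficientSolver R
  open import Relation.Binary.Reasoning.Setoid setoid
  open import Algebra.Properties.Semiring.Exp semiring public
  open import Algebra.Properties.CommutativeSemiring.Exp commutativeSemiring public using (^-distrib-*)

  1#^n≈1# : ∀ n → 1# ^ n ≈ 1#
  1#^n≈1# zero    = refl
  1#^n≈1# (suc n) = trans (*-identityˡ _) (1#^n≈1# n)

  x≈1⇒x^n≈1 : ∀ {x} n → x ≈ 1# → x ^ n ≈ 1#
  x≈1⇒x^n≈1 n x≈1 = trans (^-congˡ n x≈1) (1#^n≈1# n)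

  Cancellable : Carrier → Set (c ⊔ ℓ)
  Cancellable x = ∀ y → y * x ≈ 0# → y ≈ 0#

  Cancellable-resp-≈ : ∀ {x y} → x ≈ y → Cancellable x → Cancellable y
  Cancellable-resp-≈ x≈y cancel z z*y≈0 = cancel z (trans (*-congˡ x≈y) z*y≈0)

  Cancellable-^ : ∀ {a} → Cancellable a → ∀ n → Cancellable (a ^ n)
  Cancellable-^ cancel zero    y y*1≈0 = trans (sym (*-identityʳ y)) y*1≈0
  Cancellable-^ cancel (suc n) y y*aaⁿ≈0 = cancel y (Cancellable-^ cancel n (y * _) (trans (*-assoc y _ _) y*aaⁿ≈0))

  Cancellable⇒*-cancelˡ : ∀ {a x y} → Cancellable a → a * x ≈ a * y → x ≈ y
  Cancellable⇒*-cancelˡ {a} {x} {y} cancel ax≈ay = begin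
    x             ≈⟨ solve 2 (λ x y → x := (x :- y) :+ y) refl x y ⟩
    (x - y) + y   ≈⟨ +-congʳ (cancel (x - y) (begin
      (x - y) * a   ≈⟨ solve 3 (λ a x y → (x :- y) :* a := a :* x :- a :* y) refl a x y ⟩
      a * x - a * y ≈⟨ +-congʳ ax≈ay ⟩
      a * y - a * y ≈⟨ -‿inverseʳ (a * y) ⟩
      0#            ∎)) ⟩
    0# + y        ≈⟨ +-identityˡ y ⟩
    y             ∎

module MonicPolynomials {c ℓ} (R : CommutativeRing c ℓ) where

  open CommutativeRing R
  open ExpAndCancellation R
  open IntegerCoefficientSolver R
  open import Relation.Binary.Reasoning.Setoid setoid

  -- c₀ ∷ c₁ ∷ ⋯ ∷ cₙ₋₁ ∷ [] stands for the monic polynomial c₀ + c₁X + ⋯ + cₙ₋₁Xⁿ⁻¹ + Xⁿ.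
  evalMonic : List Carrier → Carrier → Carrier
  evalMonic []       x = 1#
  evalMonic (c ∷ cs) x = c + x * evalMonic cs x

  quotientByRoot : List Carrier → Carrier → List Carrier
  quotientByRoot []       r = []
  quotientByRoot (c ∷ cs) r = evalMonic (c ∷ cs) r ∷ quotientByRoot cs r

  length-quotientByRoot : ∀ cs r → length (quotientByRoot cs r) ≡ length cs
  length-quotientByRoot []       r = ≡.refl
  length-quotientByRoot (c ∷ cs) r = ≡.cong suc (length-quotientByRoot cs r)

  division-by-linear : ∀ c cs x r →
    evalMonic (c ∷ cs) x ≈ (x - r) * evalMonic (quotientByRoot cs r) x + evalMonic (c ∷ cs) r
  division-by-linear c []        x r =
    solve 3 (λ c x r → c :+ x :* con 1ℤ := (x :- r) :* con 1ℤ :+ (c :+ r :* con 1ℤ)) refl c x r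
  division-by-linear c (c′ ∷ cs) x r = begin
    c + x * evalMonic (c′ ∷ cs) x
      ≈⟨ +-congˡ (*-congˡ (division-by-linear c′ cs x r)) ⟩
    c + x * ((x - r) * q + f)
      ≈⟨ solve 5 (λ c x r q f → c :+ x :* ((x :- r) :* q :+ f) := (x :- r) :* (f :+ x :* q) :+ (c :+ r :* f))
               refl c x r q f ⟩
    (x - r) * (f + x * q) + (c + r * f) ∎
    where
      q = evalMonic (quotientByRoot cs r) x
      f = evalMonic (c′ ∷ cs) r

  length-roots≤degree : 1# ≉ 0# → ∀ cs {rs} → All (λ r → evalMonic cs r ≈ 0#) rs →
                        AllPairs (λ r s → Cancellable (s - r)) rs → length rs ℕ.≤ length cs
  length-roots≤degree 1≉0 cs       {[]}     _          _           = ℕ.z≤n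
  length-roots≤degree 1≉0 []       {r ∷ rs} (1≈0 ∷ _)  _           = contradiction 1≈0 1≉0
  length-roots≤degree 1≉0 (c ∷ cs) {r ∷ rs} (fr≈0 ∷ fs≈0) (cancel ∷ pairs) =
    ≡.subst (suc (length rs) ℕ.≤_) (≡.cong suc (length-quotientByRoot cs r))
      (ℕ.s≤s (length-roots≤degree 1≉0 (quotientByRoot cs r) (quotient-roots cancel fs≈0) pairs))
    where
      quotient-roots : ∀ {ss} → All (λ s → Cancellable (s - r)) ss → All (λ s → evalMonic (c ∷ cs) s ≈ 0#) ss →
                       All (λ s → evalMonic (quotientByRoot cs r) s ≈ 0#) ss
      quotient-roots {[]}     []                  []              = []
      quotient-roots {s ∷ ss} (cancel-s-r ∷ rest) (fs≈0′ ∷ fss≈0) = cancel-s-r q (begin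
        q * (s - r)                        ≈⟨ *-comm q (s - r) ⟩
        (s - r) * q                        ≈⟨ +-identityʳ _ ⟨
        (s - r) * q + 0#                   ≈⟨ +-congˡ fr≈0 ⟨
        (s - r) * q + evalMonic (c ∷ cs) r ≈⟨ division-by-linear c cs s r ⟨
        evalMonic (c ∷ cs) s               ≈⟨ fs≈0′ ⟩
        0#                                 ∎) ∷ quotient-roots rest fss≈0
        where q = evalMonic (quotientByRoot cs r) s

  evalMonic-shift : ∀ n cs x → evalMonic (replicate n 0# ++ cs) x ≈ x ^ n * evalMonic cs x
  evalMonic-shift zero    cs x = sym (*-identityˡ _)
  evalMonic-shift (suc n) cs x = begin
    0# + x * evalMonic (replicate n 0# ++ cs) x ≈⟨ +-congˡ (*-congˡ (evalMonic-shift n cs x)) ⟩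
    0# + x * (x ^ n * evalMonic cs x)          ≈⟨ +-identityˡ _ ⟩
    x * (x ^ n * evalMonic cs x)               ≈⟨ *-assoc x _ _ ⟨
    x * x ^ n * evalMonic cs x                 ∎

  evalMonic-monomial : ∀ n x → evalMonic (replicate n 0#) x ≈ x ^ n
  evalMonic-monomial n x = trans (≡.subst (λ cs → evalMonic cs x ≈ x ^ n * 1#) (++-identityʳ (replicate n 0#))
                                          (evalMonic-shift n [] x))
                                 (*-identityʳ _)

  -- Σ_{i ≤ j} γ^(j−i) X^(i(d+1)), the quotient of X^((j+1)(d+1)) − γ^(j+1) by X^(d+1) − γ.
  geometricQuotient : Carrier → ℕ → ℕ → List Carrier
  geometricQuotient γ d zero    = []
  geometricQuotient γ d (suc j) = (γ ^ suc j ∷ replicate d 0#) ++ geometricQuotient γ d j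

  length-geometricQuotient : ∀ γ d j → length (geometricQuotient γ d j) ≡ j ℕ.* suc d
  length-geometricQuotient γ d zero    = ≡.refl
  length-geometricQuotient γ d (suc j) = ≡.trans (length-++ (γ ^ suc j ∷ replicate d 0#))
    (≡.cong₂ ℕ._+_ (≡.cong suc (length-replicate d)) (length-geometricQuotient γ d j))

  geometricQuotient-factor : ∀ γ d j x →
    (x ^ suc d - γ) * evalMonic (geometricQuotient γ d j) x ≈ x ^ (suc j ℕ.* suc d) - γ ^ suc j
  geometricQuotient-factor γ d zero x = begin
    (x ^ suc d - γ) * 1#     ≈⟨ *-identityʳ _ ⟩
    x ^ suc d - γ            ≈⟨ +-cong (^-congʳ x (ℕ.+-identityʳ (suc d))) (-‿cong (*-identityʳ γ)) ⟨
    x ^ (1 ℕ.* suc d) - γ ^ 1 ∎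
  geometricQuotient-factor γ d (suc j) x = begin
    (X - γ) * (G + x * evalMonic (replicate d 0# ++ geometricQuotient γ d j) x)
      ≈⟨ *-congˡ (+-congˡ (*-congˡ (evalMonic-shift d _ x))) ⟩
    (x * x ^ d - γ) * (G + x * (x ^ d * Q))
      ≈⟨ solve 5 (λ x A γ G Q → (x :* A :- γ) :* (G :+ x :* (A :* Q)) := x :* A :* (G :+ (x :* A :- γ) :* Q) :- γ :* G)
               refl x (x ^ d) γ G Q ⟩
    X * (G + (X - γ) * Q) - γ * G
      ≈⟨ +-congʳ (*-congˡ (+-congˡ (geometricQuotient-factor γ d j x))) ⟩
    X * (G + (x ^ (suc j ℕ.* suc d) - G)) - γ * G
      ≈⟨ +-congʳ (*-congˡ (solve 2 (λ G Y → G :+ (Y :- G) := Y) refl G _)) ⟩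
    X * x ^ (suc j ℕ.* suc d) - γ * G
      ≈⟨ +-congʳ (^-homo-* x (suc d) (suc j ℕ.* suc d)) ⟨
    x ^ (suc (suc j) ℕ.* suc d) - γ ^ suc (suc j) ∎
    where
      X = x ^ suc d
      G = γ ^ suc j
      Q = evalMonic (geometricQuotient γ d j) x

[1+k]*[1+n]C[1+k]≡[1+n]*nCk : ∀ n k → suc k ℕ.* (suc n ℕ.C suc k) ≡ suc n ℕ.* (n ℕ.C k)
[1+k]*[1+n]C[1+k]≡[1+n]*nCk zero    zero    = ≡.refl
[1+k]*[1+n]C[1+k]≡[1+n]*nCk zero    (suc k) = begin
  suc (suc k) ℕ.* (1 ℕ.C suc (suc k))  ≡⟨ ≡.cong (suc (suc k) ℕ.*_) (ℕ.k>n⇒nCk≡0 {1} {suc (suc k)} (ℕ.s≤s (ℕ.s≤s ℕ.z≤n))) ⟩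
  suc (suc k) ℕ.* 0                  ≡⟨ ℕ.*-zeroʳ (suc (suc k)) ⟩
  0                                  ≡⟨ ≡.cong (1 ℕ.*_) (ℕ.k>n⇒nCk≡0 {0} {suc k} (ℕ.s≤s ℕ.z≤n)) ⟨
  1 ℕ.* (0 ℕ.C suc k)                  ∎
  where open ≡.≡-Reasoning
[1+k]*[1+n]C[1+k]≡[1+n]*nCk (suc n) zero    = ≡.trans (ℕ.*-identityˡ _) (≡.trans (ℕ.nC1≡n (suc (suc n))) (≡.sym (ℕ.*-identityʳ _)))
[1+k]*[1+n]C[1+k]≡[1+n]*nCk (suc n) (suc k) = begin
  suc (suc k) ℕ.* (suc (suc n) ℕ.C suc (suc k))              ≡⟨ ≡.cong (suc (suc k) ℕ.*_) (ℕ.nCk+nC[k+1]≡[n+1]C[k+1] (suc n) (suc k)) ⟨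
  suc (suc k) ℕ.* (A ℕ.+ B)                                ≡⟨ rearrange k A B ⟩
  A ℕ.+ (suc k ℕ.* A ℕ.+ suc (suc k) ℕ.* B)                ≡⟨ ≡.cong₂ (λ a b → A ℕ.+ (a ℕ.+ b))
                                                                ([1+k]*[1+n]C[1+k]≡[1+n]*nCk n k)
                                                                ([1+k]*[1+n]C[1+k]≡[1+n]*nCk n (suc k)) ⟩
  A ℕ.+ (suc n ℕ.* (n ℕ.C k) ℕ.+ suc n ℕ.* (n ℕ.C suc k))      ≡⟨ ≡.cong (A ℕ.+_) (ℕ.*-distribˡ-+ (suc n) (n ℕ.C k) (n ℕ.C suc k)) ⟨
  A ℕ.+ suc n ℕ.* (n ℕ.C k ℕ.+ n ℕ.C suc k)                    ≡⟨ ≡.cong (λ a → A ℕ.+ suc n ℕ.* a) (ℕ.nCk+nC[k+1]≡[n+1]C[k+1] n k) ⟩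
  suc (suc n) ℕ.* A                                        ∎
  where
    open ≡.≡-Reasoning
    A = suc n ℕ.C suc k
    B = suc n ℕ.C suc (suc k)
    rearrange : ∀ k a b → suc (suc k) ℕ.* (a ℕ.+ b) ≡ a ℕ.+ (suc k ℕ.* a ℕ.+ suc (suc k) ℕ.* b)
    rearrange = ℕ-Solver.solve-∀

prime∣pCk : ∀ {p k} → Prime p → 0 ℕ.< k → k ℕ.< p → p ℕ.∣ p ℕ.C k
prime∣pCk {suc n} {suc k} isPrime _ k<p
  with euclidsLemma (suc k) (suc n ℕ.C suc k) isPrime
         (ℕ.divides (n ℕ.C k) (≡.trans ([1+k]*[1+n]C[1+k]≡[1+n]*nCk n k) (ℕ.*-comm (suc n) (n ℕ.C k))))
... | inj₁ p∣1+k = contradiction (ℕ.∣⇒≤ p∣1+k) (ℕ.<⇒≱ k<p)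
... | inj₂ p∣pCk = p∣pCk

odd-prime⇒2<p : ∀ {p h} → Prime p → p ≡ suc (h ℕ.+ h) → 2 ℕ.< p
odd-prime⇒2<p {h = zero}  isPrime ≡.refl = contradiction isPrime ¬prime[1]
odd-prime⇒2<p {h = suc h} isPrime ≡.refl = ℕ.s≤s (ℕ.s≤s (ℕ.≤-trans (ℕ.s≤s ℕ.z≤n) (ℕ.m≤n+m (suc h) h)))

even⊎odd : ∀ n → (∃[ h ] n ≡ h ℕ.+ h) ⊎ (∃[ h ] n ≡ suc (h ℕ.+ h))
even⊎odd zero    = inj₁ (0 , ≡.refl)
even⊎odd (suc n) with even⊎odd n
... | inj₁ (h , n≡2h)   = inj₂ (h , ≡.cong suc n≡2h)
... | inj₂ (h , n≡1+2h) = inj₁ (suc h , ≡.cong suc (≡.trans n≡1+2h (≡.sym (ℕ.+-suc h h))))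

prime≢2⇒odd : ∀ {p} → Prime p → p ≢ 2 → ∃[ h ] p ≡ suc (h ℕ.+ h)
prime≢2⇒odd {p} isPrime p≢2 with even⊎odd p
... | inj₂ odd = odd
... | inj₁ (h , p≡2h) with prime⇒irreducible isPrime (ℕ.divides h (≡.trans p≡2h (h+h≡h*2 h)))
  where
    h+h≡h*2 : ∀ h → h ℕ.+ h ≡ h ℕ.* 2
    h+h≡h*2 = ℕ-Solver.solve-∀
...   | inj₁ ()
...   | inj₂ 2≡p = contradiction (≡.sym 2≡p) p≢2

module CharacteristicPrime {c ℓ} (R : CommutativeRing c ℓ) where

  open CommutativeRing R
  open FromInteger R
  open ExpAndCancellation R
  open IntegerCoefficientSolver R
  open import Algebra.Properties.Semiring.Mult semiring using (_×_; ×-assoc-*; ×1-homo-*)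
  open import Algebra.Properties.Semiring.Mult.TCOptimised semiring using (×ᵤ≈×)
  open import Algebra.Properties.Monoid.Sum +-monoid using (sum; sum-init-last; sum-cong-≋; sum-replicate-zero)
  import Algebra.Properties.CommutativeSemiring.Binomial commutativeSemiring as Binomial
  open import Relation.Binary.Reasoning.Setoid setoid

  inner-binomials-vanish⇒additive : ∀ n → (∀ k → 0 ℕ.< k → k ℕ.< suc n → ∀ z → (suc n ℕ.C k) × z ≈ 0#) →
                                    ∀ x y → (x + y) ^ suc n ≈ x ^ suc n + y ^ suc n
  inner-binomials-vanish⇒additive n vanish x y = begin
    (x + y) ^ suc n                 ≈⟨ Binomial.theorem (suc n) x y ⟩
    sum term                        ≈⟨ +-congˡ (sum-init-last (term ∘ Fin.suc)) ⟩
    term Fin.zero + (sum (term ∘ Fin.suc ∘ Fin.inject₁) + term (Fin.fromℕ (suc n)))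
                                    ≈⟨ +-congˡ (+-congʳ (trans (sum-cong-≋ inner-vanish) (sum-replicate-zero n))) ⟩
    term Fin.zero + (0# + term (Fin.fromℕ (suc n)))
                                    ≈⟨ +-cong first (trans (+-identityˡ _) last) ⟩
    y ^ suc n + x ^ suc n           ≈⟨ +-comm _ _ ⟩
    x ^ suc n + y ^ suc n           ∎
    where
      term = Binomial.binomialTerm x y (suc n)
      inner-vanish : ∀ j → term (Fin.suc (Fin.inject₁ j)) ≈ 0#
      inner-vanish j = vanish _ (ℕ.s≤s ℕ.z≤n)
        (ℕ.s≤s (≡.subst (ℕ._< n) (≡.sym (Fin.toℕ-inject₁ j)) (Fin.toℕ<n j))) _
      first : term Fin.zero ≈ y ^ suc n
      first = trans (+-identityʳ _) (*-identityˡ _)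
      last : term (Fin.fromℕ (suc n)) ≈ x ^ suc n
      last = begin
        term (Fin.fromℕ (suc n))                      ≡⟨ ≡.cong (λ e → (suc n ℕ.C e) × (x ^ e * y ^ (suc n ℕ.∸ e))) (Fin.toℕ-fromℕ (suc n)) ⟩
        (suc n ℕ.C suc n) × (x ^ suc n * y ^ (n ℕ.∸ n)) ≡⟨ ≡.cong₂ (λ c e → c × (x ^ suc n * y ^ e)) (ℕ.nCn≡1 (suc n)) (ℕ.n∸n≡0 n) ⟩
        1 × (x ^ suc n * 1#)                          ≈⟨ +-identityʳ _ ⟩
        x ^ suc n * 1#                                ≈⟨ *-identityʳ _ ⟩
        x ^ suc n                                     ∎

  module _ {p} (isPrime : Prime p) (characteristic : fromℤ (+ p) ≈ 0#) where

    private instance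
      p≢0 : ℕ.NonZero p
      p≢0 = prime⇒nonZero isPrime

    multiple-of-p-vanishes : ∀ {m} → p ℕ.∣ m → ∀ x → m × x ≈ 0#
    multiple-of-p-vanishes {m} (ℕ.divides q ≡.refl) x = begin
      (q ℕ.* p) × x             ≈⟨ ×-congʳ (q ℕ.* p) (*-identityˡ x) ⟨
      (q ℕ.* p) × (1# * x)      ≈⟨ ×-assoc-* (q ℕ.* p) 1# x ⟨
      (q ℕ.* p) × 1# * x        ≈⟨ *-congʳ (×1-homo-* q p) ⟩
      q × 1# * p × 1# * x       ≈⟨ *-congʳ (*-congˡ (trans (×ᵤ≈× p 1#) characteristic)) ⟩
      q × 1# * 0# * x           ≈⟨ trans (*-congʳ (zeroʳ _)) (zeroˡ x) ⟩
      0#                        ∎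
      where open import Algebra.Properties.Semiring.Mult semiring using (×-congʳ)

    freshman's-dream : ∀ x y → (x + y) ^ p ≈ x ^ p + y ^ p
    freshman's-dream x y = ≡.subst (λ q → (x + y) ^ q ≈ x ^ q + y ^ q) (ℕ.suc-pred p)
      (inner-binomials-vanish⇒additive (ℕ.pred p)
        (λ k 0<k k<p → multiple-of-p-vanishes (≡.subst (λ q → p ℕ.∣ q ℕ.C k) (≡.sym (ℕ.suc-pred p))
          (prime∣pCk isPrime 0<k (≡.subst (k ℕ.<_) (ℕ.suc-pred p) k<p)))) x y)

    0#^p≈0# : 0# ^ p ≈ 0#
    0#^p≈0# = ≡.subst (λ q → 0# ^ q ≈ 0#) (ℕ.suc-pred p) (zeroˡ _)

    fixed-by-^p-neg : ∀ {z} → z ^ p ≈ z → (- z) ^ p ≈ - z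
    fixed-by-^p-neg {z} z^p≈z = begin
      (- z) ^ p                     ≈⟨ solve 2 (λ A B → B := :- A :+ (A :+ B)) refl (z ^ p) ((- z) ^ p) ⟩
      - z ^ p + (z ^ p + (- z) ^ p) ≈⟨ +-cong (-‿cong z^p≈z) (sym (freshman's-dream z (- z))) ⟩
      - z + (z - z) ^ p             ≈⟨ +-congˡ (trans (^-congˡ p (-‿inverseʳ z)) 0#^p≈0#) ⟩
      - z + 0#                      ≈⟨ +-identityʳ _ ⟩
      - z                           ∎

    private
      fermat-ℕ : ∀ n → fromℤ (+ n) ^ p ≈ fromℤ (+ n)
      fermat-ℕ zero    = 0#^p≈0#
      fermat-ℕ (suc n) = begin
        fromℤ (1ℤ ℤ.+ + n) ^ p        ≈⟨ ^-congˡ p (fromℤ-+ 1ℤ (+ n)) ⟩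
        (1# + fromℤ (+ n)) ^ p        ≈⟨ freshman's-dream 1# _ ⟩
        1# ^ p + fromℤ (+ n) ^ p      ≈⟨ +-cong (1#^n≈1# p) (fermat-ℕ n) ⟩
        1# + fromℤ (+ n)              ≈⟨ fromℤ-+ 1ℤ (+ n) ⟨
        fromℤ (+ suc n)               ∎

    fermat : ∀ i → fromℤ i ^ p ≈ fromℤ i
    fermat (+ n)    = fermat-ℕ n
    fermat -[1+ n ] = fixed-by-^p-neg (fermat-ℕ (suc n))

module BinetFormulas {c ℓ} (R : CommutativeRing c ℓ) where

  open CommutativeRing R
  open FromInteger R
  open ExpAndCancellation R
  open IntegerCoefficientSolver R
  open import Relation.Binary.Reasoning.Setoid setoid

  module _ {P Q : ℤ} {r s : Carrier} (sum : fromℤ P ≈ r + s) (product : fromℤ Q ≈ r * s) where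

    private
      fromℤ-recurrence : ∀ A B → fromℤ (P ℤ.* A ℤ.- Q ℤ.* B) ≈ (r + s) * fromℤ A - (r * s) * fromℤ B
      fromℤ-recurrence A B = begin
        fromℤ (P ℤ.* A ℤ.- Q ℤ.* B)              ≈⟨ fromℤ-+ (P ℤ.* A) _ ⟩
        fromℤ (P ℤ.* A) + fromℤ (ℤ.- (Q ℤ.* B))  ≈⟨ +-cong (fromℤ-* P A) (trans (fromℤ-neg (Q ℤ.* B)) (-‿cong (fromℤ-* Q B))) ⟩
        fromℤ P * fromℤ A - fromℤ Q * fromℤ B    ≈⟨ +-cong (*-congʳ sum) (-‿cong (*-congʳ product)) ⟩
        (r + s) * fromℤ A - (r * s) * fromℤ B    ∎

    binet-U : ∀ n → (r - s) * fromℤ (U n P Q) ≈ r ^ n - s ^ n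
    binet-U zero          = solve 2 (λ r s → (r :- s) :* con 0ℤ := con 1ℤ :- con 1ℤ) refl r s
    binet-U (suc zero)    = solve 2 (λ r s → (r :- s) :* con 1ℤ := r :* con 1ℤ :- s :* con 1ℤ) refl r s
    binet-U (suc (suc n)) = begin
      (r - s) * fromℤ (P ℤ.* U₁ ℤ.- Q ℤ.* U₀)
        ≈⟨ *-congˡ (fromℤ-recurrence U₁ U₀) ⟩
      (r - s) * ((r + s) * fromℤ U₁ - (r * s) * fromℤ U₀)
        ≈⟨ solve 4 (λ r s A B → (r :- s) :* ((r :+ s) :* A :- (r :* s) :* B)
                               := (r :+ s) :* ((r :- s) :* A) :- (r :* s) :* ((r :- s) :* B)) refl r s (fromℤ U₁) (fromℤ U₀) ⟩
      (r + s) * ((r - s) * fromℤ U₁) - (r * s) * ((r - s) * fromℤ U₀)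
        ≈⟨ +-cong (*-congˡ (binet-U (suc n))) (-‿cong (*-congˡ (binet-U n))) ⟩
      (r + s) * (r * r ^ n - s * s ^ n) - (r * s) * (r ^ n - s ^ n)
        ≈⟨ solve 4 (λ r s A B → (r :+ s) :* (r :* A :- s :* B) :- (r :* s) :* (A :- B)
                               := r :* (r :* A) :- s :* (s :* B)) refl r s (r ^ n) (s ^ n) ⟩
      r ^ suc (suc n) - s ^ suc (suc n) ∎
      where
        U₁ = U (suc n) P Q
        U₀ = U n P Q

    binet-V : ∀ n → fromℤ (V n P Q) ≈ r ^ n + s ^ n
    binet-V zero          = refl
    binet-V (suc zero)    = trans sum (+-cong (sym (*-identityʳ r)) (sym (*-identityʳ s)))
    binet-V (suc (suc n)) = begin
      fromℤ (P ℤ.* V₁ ℤ.- Q ℤ.* V₀)                              ≈⟨ fromℤ-recurrence V₁ V₀ ⟩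
      (r + s) * fromℤ V₁ - (r * s) * fromℤ V₀                    ≈⟨ +-cong (*-congˡ (binet-V (suc n))) (-‿cong (*-congˡ (binet-V n))) ⟩
      (r + s) * (r * r ^ n + s * s ^ n) - (r * s) * (r ^ n + s ^ n)
        ≈⟨ solve 4 (λ r s A B → (r :+ s) :* (r :* A :+ s :* B) :- (r :* s) :* (A :+ B)
                               := r :* (r :* A) :+ s :* (s :* B)) refl r s (r ^ n) (s ^ n) ⟩
      r ^ suc (suc n) + s ^ suc (suc n) ∎
      where
        V₁ = V (suc n) P Q
        V₀ = V n P Q

module PowerMapOnSubgroup {c ℓ} (R : CommutativeRing c ℓ) where

  open CommutativeRing R
  open ExpAndCancellation R
  open MonicPolynomials R
  open IntegerCoefficientSolver R
  open import Data.Product using (_×_)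
  open import Relation.Binary.Reasoning.Setoid setoid

  module _ {g} {G : Carrier → Set g}
    (G-^ : ∀ {x} → G x → ∀ n → G (x ^ n))
    (G-inverse : ∀ {x} → G x → ∃[ y ] (G y × x * y ≈ 1#))
    (distinct⇒cancellable : ∀ {x y} → G x → G y → x ≉ y → Cancellable (x - y))
    (_≟_ : Decidable _≈_)
    (1≉0 : 1# ≉ 0#)
    {m : ℕ} .{{_ : ℕ.NonZero m}} (exponent : ∀ {x} → G x → x ^ m ≈ 1#)
    {elements : List Carrier} (elements-in-G : All G elements) (elements-distinct : AllPairs _≉_ elements)
    (enough : m ℕ.≤ length elements)
    where

    private
      non-roots-bounded : ∀ {k d γ} → suc k ℕ.* suc d ≡ m → G γ → γ ^ suc k ≈ 1# →
                          All (λ β → β ^ suc d ≉ γ) elements → length elements ℕ.≤ k ℕ.* suc d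
      non-roots-bounded {k} {d} {γ} kd≡m Gγ γ^k≈1 none = ≡.subst (length elements ℕ.≤_) (length-geometricQuotient γ d k)
        (length-roots≤degree 1≉0 (geometricQuotient γ d k) (All.zipWith root (elements-in-G , none))
          (AllPairs-zipWithAll (λ Gr Gs r≉s → distinct⇒cancellable Gs Gr (r≉s ∘ sym)) elements-in-G elements-distinct))
        where
          root : ∀ {β} → G β × β ^ suc d ≉ γ → evalMonic (geometricQuotient γ d k) β ≈ 0#
          root {β} (Gβ , β^d≉γ) = distinct⇒cancellable (G-^ Gβ (suc d)) Gγ β^d≉γ _ (trans (*-comm _ _) (begin
            (β ^ suc d - γ) * evalMonic (geometricQuotient γ d k) β ≈⟨ geometricQuotient-factor γ d k β ⟩
            β ^ (suc k ℕ.* suc d) - γ ^ suc k                      ≈⟨ +-cong (trans (^-congʳ β kd≡m) (exponent Gβ)) (-‿cong γ^k≈1) ⟩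
            1# - 1#                                                ≈⟨ -‿inverseʳ 1# ⟩
            0#                                                     ∎))

    dth-root : ∀ {k d} → k ℕ.* d ≡ m → ∀ {γ} → G γ → γ ^ k ≈ 1# → ∃[ β ] (G β × β ^ d ≈ γ)
    dth-root {zero}  {d}     kd≡m = contradiction (≡.sym kd≡m) (ℕ.≢-nonZero⁻¹ m)
    dth-root {suc k} {zero}  kd≡m = contradiction (≡.trans (≡.sym kd≡m) (ℕ.*-zeroʳ (suc k))) (ℕ.≢-nonZero⁻¹ m)
    dth-root {suc k} {suc d} kd≡m {γ} Gγ γ^k≈1 with any? (λ β → (β ^ suc d) ≟ γ) elements
    ... | yes found = Any.lookup found , lookupAny elements-in-G found
    ... | no none   = contradiction (ℕ.≤-trans enough (non-roots-bounded {k} {d} kd≡m Gγ γ^k≈1 (¬Any⇒All¬ elements none)))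
                        (ℕ.<⇒≱ (≡.subst (k ℕ.* suc d ℕ.<_) kd≡m (ℕ.m<n+m (k ℕ.* suc d) (ℕ.s≤s ℕ.z≤n))))

    private
      powers-of-β-vanish : ∀ {β} → G β → ∀ y → β ^ (y ℕ.* m) ≈ 1#
      powers-of-β-vanish {β} Gβ y = begin
        β ^ (y ℕ.* m)   ≡⟨ ≡.cong (β ^_) (ℕ.*-comm y m) ⟩
        β ^ (m ℕ.* y)   ≈⟨ ^-assocʳ β m y ⟨
        (β ^ m) ^ y     ≈⟨ x≈1⇒x^n≈1 y (exponent Gβ) ⟩
        1#              ∎

      root-from-bézout : ∀ {n β γ} → G β → β ^ gcd n m ≈ γ → Bézout.Identity (gcd n m) n m → ∃[ α ] (G α × α ^ n ≈ γ)
      root-from-bézout {n} {β} {γ} Gβ β^d≈γ (Bézout.+- x y d+ym≡xn) = β ^ x , G-^ Gβ x , (begin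
        (β ^ x) ^ n                       ≈⟨ ^-assocʳ β x n ⟩
        β ^ (x ℕ.* n)                     ≡⟨ ≡.cong (β ^_) d+ym≡xn ⟨
        β ^ (gcd n m ℕ.+ y ℕ.* m)         ≈⟨ ^-homo-* β (gcd n m) (y ℕ.* m) ⟩
        β ^ gcd n m * β ^ (y ℕ.* m)       ≈⟨ *-cong β^d≈γ (powers-of-β-vanish Gβ y) ⟩
        γ * 1#                            ≈⟨ *-identityʳ γ ⟩
        γ                                 ∎)
      root-from-bézout {n} {β} {γ} Gβ β^d≈γ (Bézout.-+ x y d+xn≡ym) with G-inverse Gβ
      ... | β⁻¹ , Gβ⁻¹ , ββ⁻¹≈1 = β⁻¹ ^ x , G-^ Gβ⁻¹ x , (begin
        (β⁻¹ ^ x) ^ n                     ≈⟨ *-identityˡ _ ⟨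
        1# * (β⁻¹ ^ x) ^ n                ≈⟨ *-congʳ γ[β^x]^n≈1 ⟨
        γ * (β ^ x) ^ n * (β⁻¹ ^ x) ^ n   ≈⟨ *-assoc γ _ _ ⟩
        γ * ((β ^ x) ^ n * (β⁻¹ ^ x) ^ n) ≈⟨ *-congˡ (^-distrib-* (β ^ x) (β⁻¹ ^ x) n) ⟨
        γ * (β ^ x * β⁻¹ ^ x) ^ n         ≈⟨ *-congˡ (x≈1⇒x^n≈1 n (trans (sym (^-distrib-* β β⁻¹ x)) (x≈1⇒x^n≈1 x ββ⁻¹≈1))) ⟩
        γ * 1#                            ≈⟨ *-identityʳ γ ⟩
        γ                                 ∎)
        where
          γ[β^x]^n≈1 : γ * (β ^ x) ^ n ≈ 1#
          γ[β^x]^n≈1 = begin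
            γ * (β ^ x) ^ n               ≈⟨ *-cong (sym β^d≈γ) (^-assocʳ β x n) ⟩
            β ^ gcd n m * β ^ (x ℕ.* n)   ≈⟨ ^-homo-* β (gcd n m) (x ℕ.* n) ⟨
            β ^ (gcd n m ℕ.+ x ℕ.* n)     ≡⟨ ≡.cong (β ^_) d+xn≡ym ⟩
            β ^ (y ℕ.* m)                 ≈⟨ powers-of-β-vanish Gβ y ⟩
            1#                            ∎

    nth-root : ∀ {n k} → k ℕ.* gcd n m ≡ m → ∀ {γ} → G γ → γ ^ k ≈ 1# → ∃[ α ] (G α × α ^ n ≈ γ)
    nth-root {n} {k} kd≡m Gγ γ^k≈1 =
      let β , Gβ , β^d≈γ = dth-root {k} {gcd n m} kd≡m Gγ γ^k≈1 in root-from-bézout Gβ β^d≈γ (Bézout.identity (gcd-GCD n m))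

    nth-power-order : ∀ {n k} → k ℕ.* gcd n m ≡ m → ∀ {α} → G α → (α ^ n) ^ k ≈ 1#
    nth-power-order {n} {k} kd≡m {α} Gα with gcd[m,n]∣m n m
    ... | ℕ.divides q n≡qd = begin
      (α ^ n) ^ k                      ≈⟨ ^-assocʳ α n k ⟩
      α ^ (n ℕ.* k)                    ≡⟨ ≡.cong (λ e → α ^ (e ℕ.* k)) n≡qd ⟩
      α ^ (q ℕ.* gcd n m ℕ.* k)        ≡⟨ ≡.cong (α ^_) (rearrange q (gcd n m) k) ⟩
      α ^ (k ℕ.* gcd n m ℕ.* q)        ≡⟨ ≡.cong (λ e → α ^ (e ℕ.* q)) kd≡m ⟩
      α ^ (m ℕ.* q)                    ≡⟨ ≡.cong (α ^_) (ℕ.*-comm m q) ⟩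
      α ^ (q ℕ.* m)                    ≈⟨ powers-of-β-vanish Gα q ⟩
      1#                               ∎
      where
        rearrange : ∀ a b c → a ℕ.* b ℕ.* c ≡ c ℕ.* b ℕ.* a
        rearrange = ℕ-Solver.solve-∀

    nth-power⇔ : ∀ {n k} → k ℕ.* gcd n m ≡ m → ∀ {γ} → G γ → (∃[ α ] (G α × α ^ n ≈ γ)) ⇔ γ ^ k ≈ 1#
    nth-power⇔ {n} {k} kd≡m Gγ = mk⇔
      (λ (α , Gα , α^n≈γ) → trans (^-congˡ k (sym α^n≈γ)) (nth-power-order {n} {k} kd≡m Gα))
      (nth-root {n} {k} kd≡m Gγ)

module IntegersModulo (p : ℕ) where

  open import Data.Integer using (_+_; _*_; _-_; -_)

  infix 4 _≡ₚ_ _≢ₚ_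
  -- A record rather than a function, so that a and b can be inferred from a proof.
  record _≡ₚ_ (a b : ℤ) : Set where
    constructor ∣⇒≡ₚ
    field ≡ₚ⇒∣ : + p ℤ.∣ a - b
  open _≡ₚ_ public

  _≢ₚ_ : ℤ → ℤ → Set
  a ≢ₚ b = ¬ (a ≡ₚ b)

  ≡⇒≡ₚ : ∀ {a b} → a ≡ b → a ≡ₚ b
  ≡⇒≡ₚ {a} ≡.refl = ∣⇒≡ₚ (ℤ.divides 0ℤ (ℤ.+-inverseʳ a))

  private
    via : ∀ {a b c} → a - b ≡ c → + p ℤ.∣ c → a ≡ₚ b
    via eq p∣c = ∣⇒≡ₚ (≡.subst (+ p ℤ.∣_) (≡.sym eq) p∣c)

    sym-difference : ∀ a b → b - a ≡ - (a - b)
    sym-difference = solve-∀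
    trans-difference : ∀ a b c → a - c ≡ (a - b) + (b - c)
    trans-difference = solve-∀
    +-difference : ∀ a b c d → (a + c) - (b + d) ≡ (a - b) + (c - d)
    +-difference = solve-∀
    *-difference : ∀ a b c d → a * c - b * d ≡ a * (c - d) + (a - b) * d
    *-difference = solve-∀
    neg-difference : ∀ a b → - a - - b ≡ - (a - b)
    neg-difference = solve-∀

  ≡ₚ-isEquivalence : IsEquivalence _≡ₚ_
  ≡ₚ-isEquivalence = record
    { refl  = ≡⇒≡ₚ ≡.refl
    ; sym   = λ {a} {b} (∣⇒≡ₚ p∣a-b) → via (sym-difference a b) (ℤ.∣m⇒∣-m p∣a-b)
    ; trans = λ {a} {b} {c} (∣⇒≡ₚ p∣a-b) (∣⇒≡ₚ p∣b-c) → via (trans-difference a b c) (ℤ.∣m∣n⇒∣m+n p∣a-b p∣b-c)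
    }

  ℤₚ : CommutativeRing 0ℓ 0ℓ
  ℤₚ = record
    { Carrier = ℤ
    ; _≈_ = _≡ₚ_
    ; _+_ = _+_
    ; _*_ = _*_
    ; -_ = -_
    ; 0# = 0ℤ
    ; 1# = 1ℤ
    ; isCommutativeRing = record
      { isRing = record
        { +-isAbelianGroup = record
          { isGroup = record
            { isMonoid = record
              { isSemigroup = record
                { isMagma = record
                  { isEquivalence = ≡ₚ-isEquivalence
                  ; ∙-cong = λ {a} {b} {c} {d} (∣⇒≡ₚ p∣a-b) (∣⇒≡ₚ p∣c-d) → via (+-difference a b c d) (ℤ.∣m∣n⇒∣m+n p∣a-b p∣c-d)
                  }
                ; assoc = λ a b c → ≡⇒≡ₚ (ℤ.+-assoc a b c)
                }
              ; identity = (λ a → ≡⇒≡ₚ (ℤ.+-identityˡ a)) , (λ a → ≡⇒≡ₚ (ℤ.+-identityʳ a))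
              }
            ; inverse = (λ a → ≡⇒≡ₚ (ℤ.+-inverseˡ a)) , (λ a → ≡⇒≡ₚ (ℤ.+-inverseʳ a))
            ; ⁻¹-cong = λ {a} {b} (∣⇒≡ₚ p∣a-b) → via (neg-difference a b) (ℤ.∣m⇒∣-m p∣a-b)
            }
          ; comm = λ a b → ≡⇒≡ₚ (ℤ.+-comm a b)
          }
        ; *-cong = λ {a} {b} {c} {d} (∣⇒≡ₚ p∣a-b) (∣⇒≡ₚ p∣c-d) →
            via (*-difference a b c d) (ℤ.∣m∣n⇒∣m+n (ℤ.∣n⇒∣m*n a p∣c-d) (ℤ.∣m⇒∣m*n d p∣a-b))
        ; *-assoc = λ a b c → ≡⇒≡ₚ (ℤ.*-assoc a b c)
        ; *-identity = (λ a → ≡⇒≡ₚ (ℤ.*-identityˡ a)) , (λ a → ≡⇒≡ₚ (ℤ.*-identityʳ a))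
        ; distrib = (λ a b c → ≡⇒≡ₚ (ℤ.*-distribˡ-+ a b c)) , (λ a b c → ≡⇒≡ₚ (ℤ.*-distribʳ-+ a b c))
        }
      ; *-comm = λ a b → ≡⇒≡ₚ (ℤ.*-comm a b)
      }
    }

  module ℤₚ = CommutativeRing ℤₚ
  open FromInteger ℤₚ using (fromℤ; fromℤ-+; fromℤ-neg)
  open ExpAndCancellation ℤₚ using (_^_; ^-congˡ; ^-homo-*; ^-distrib-*; Cancellable; Cancellable⇒*-cancelˡ)

  private
    fromℤ-+ℕ : ∀ n → fromℤ (+ n) ≡ₚ + n
    fromℤ-+ℕ zero    = ℤₚ.refl
    fromℤ-+ℕ (suc n) = ℤₚ.trans (fromℤ-+ 1ℤ (+ n)) (ℤₚ.+-congˡ {1ℤ} (fromℤ-+ℕ n))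

  fromℤ≡ₚ : ∀ i → fromℤ i ≡ₚ i
  fromℤ≡ₚ (+ n)    = fromℤ-+ℕ n
  fromℤ≡ₚ -[1+ n ] = ℤₚ.trans (fromℤ-neg (+ suc n)) (ℤₚ.-‿cong (fromℤ-+ℕ (suc n)))

  p≡ₚ0 : + p ≡ₚ 0ℤ
  p≡ₚ0 = ∣⇒≡ₚ (≡.subst (+ p ℤ.∣_) (≡.sym (ℤ.+-identityʳ (+ p))) ℤ.∣-refl)

  _≟ₚ_ : Decidable _≡ₚ_
  a ≟ₚ b = Dec.map′ ∣⇒≡ₚ ≡ₚ⇒∣ (+ p ℤ.∣? (a - b))

  ≡ₚ0⇒∣ : ∀ {a} → a ≡ₚ 0ℤ → + p ℤ.∣ a
  ≡ₚ0⇒∣ {a} (∣⇒≡ₚ p∣a-0) = ≡.subst (+ p ℤ.∣_) (ℤ.+-identityʳ a) p∣a-0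

  ∣⇒≡ₚ0 : ∀ {a} → + p ℤ.∣ a → a ≡ₚ 0ℤ
  ∣⇒≡ₚ0 {a} p∣a = ∣⇒≡ₚ (≡.subst (+ p ℤ.∣_) (≡.sym (ℤ.+-identityʳ a)) p∣a)

  ≢ₚ0-below-p : ∀ {n} → 0 ℕ.< n → n ℕ.< p → + n ≢ₚ 0ℤ
  ≢ₚ0-below-p {suc n} _ n<p n≡ₚ0 = contradiction (ℕ.∣⇒≤ (ℤ.∣⇒∣ᵤ (≡ₚ0⇒∣ n≡ₚ0))) (ℕ.<⇒≱ n<p)

  distinct-below-p : ∀ {a b} → b ℕ.< a → a ℕ.< p → + a ≢ₚ + b
  distinct-below-p {a} {b} b<a a<p (∣⇒≡ₚ p∣a-b) =
    ≢ₚ0-below-p (ℕ.m<n⇒0<n∸m b<a) (ℕ.≤-<-trans (ℕ.m∸n≤m a b) a<p)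
      (∣⇒≡ₚ0 (≡.subst (+ p ℤ.∣_) (≡.trans (ℤ.m-n≡m⊖n a b) (ℤ.⊖-≥ (ℕ.<⇒≤ b<a))) p∣a-b))

  difference≡ₚ0⇒≡ₚ : ∀ {a b} → a - b ≡ₚ 0ℤ → a ≡ₚ b
  difference≡ₚ0⇒≡ₚ = ∣⇒≡ₚ ∘ ≡ₚ0⇒∣

  module _ (isPrime : Prime p) where

    private instance
      p≢0 : ℕ.NonZero p
      p≢0 = prime⇒nonZero isPrime

    s≡ₚs%p : ∀ s → s ≡ₚ + (s ℤ.%ℕ p)
    s≡ₚs%p s = ∣⇒≡ₚ (ℤ.divides (s ℤ./ℕ p) (≡.trans (≡.cong (_- + (s ℤ.%ℕ p)) (ℤ.a≡a%ℕn+[a/ℕn]*n s p))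
                                                          (cancel-left (+ (s ℤ.%ℕ p)) _)))
      where
        cancel-left : ∀ r q → (r + q) - r ≡ q
        cancel-left = solve-∀

    product≡ₚ0 : ∀ {a b} → a * b ≡ₚ 0ℤ → a ≡ₚ 0ℤ ⊎ b ≡ₚ 0ℤ
    product≡ₚ0 {a} {b} ab≡ₚ0 =
      Sum.map (∣⇒≡ₚ0 ∘ ℤ.∣ᵤ⇒∣) (∣⇒≡ₚ0 ∘ ℤ.∣ᵤ⇒∣)
        (euclidsLemma ℤ.∣ a ∣ ℤ.∣ b ∣ isPrime (≡.subst (p ℕ.∣_) (ℤ.abs-* a b) (ℤ.∣⇒∣ᵤ (≡ₚ0⇒∣ ab≡ₚ0))))

    ≢ₚ0⇒cancellable : ∀ {a} → a ≢ₚ 0ℤ → Cancellable a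
    ≢ₚ0⇒cancellable a≢0 b ba≡ₚ0 with product≡ₚ0 ba≡ₚ0
    ... | inj₁ b≡ₚ0 = b≡ₚ0
    ... | inj₂ a≡ₚ0 = contradiction a≡ₚ0 a≢0

    fermat : ∀ a → a ^ p ≡ₚ a
    fermat a = ℤₚ.trans (^-congˡ p (ℤₚ.sym (fromℤ≡ₚ a)))
      (ℤₚ.trans (CharacteristicPrime.fermat ℤₚ isPrime characteristic a) (fromℤ≡ₚ a))
      where characteristic = ℤₚ.trans (fromℤ≡ₚ (+ p)) p≡ₚ0

    fermat-nonzero : ∀ {n a} → p ≡ suc n → a ≢ₚ 0ℤ → a ^ n ≡ₚ 1ℤ
    fermat-nonzero {n} {a} p≡1+n a≢0 = Cancellable⇒*-cancelˡ (≢ₚ0⇒cancellable a≢0)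
      (ℤₚ.trans (≡⇒≡ₚ (≡.cong (a ^_) (≡.sym p≡1+n))) (ℤₚ.trans (fermat a) (≡⇒≡ₚ (≡.sym (ℤ.*-identityʳ a)))))

    square≡1⇒≡±1 : ∀ {x} → x * x ≡ₚ 1ℤ → x ≡ₚ 1ℤ ⊎ x ≡ₚ -1ℤ
    square≡1⇒≡±1 {x} x²≡1 = Sum.map difference≡ₚ0⇒≡ₚ (λ x+1≡0 → ℤₚ.trans (≡⇒≡ₚ (x≡[x+1]-1 x)) (ℤₚ.+-congʳ x+1≡0))
      (product≡ₚ0 (ℤₚ.trans (≡⇒≡ₚ (difference-of-squares x)) (ℤₚ.trans (ℤₚ.+-congʳ x²≡1) (ℤₚ.-‿inverseʳ 1ℤ))))
      where
        difference-of-squares : ∀ x → (x - 1ℤ) * (x + 1ℤ) ≡ x * x - 1ℤ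
        difference-of-squares = solve-∀
        x≡[x+1]-1 : ∀ x → x ≡ (x + 1ℤ) - 1ℤ
        x≡[x+1]-1 = solve-∀

    inverse : ℤ → ℤ
    inverse a = a ^ (p ℕ.∸ 2)

    *-inverse : ∀ {a} → a ≢ₚ 0ℤ → a * inverse a ≡ₚ 1ℤ
    *-inverse = fermat-nonzero (≡.sym (ℕ.m+[n∸m]≡n (ℕ.nonTrivial⇒n>1 p {{prime⇒nonTrivial isPrime}})))

    double-injective : 2 ℕ.< p → ∀ {a b} → a + a ≡ₚ b + b → a ≡ₚ b
    double-injective 2<p {a} {b} 2a≡2b = Cancellable⇒*-cancelˡ (≢ₚ0⇒cancellable (≢ₚ0-below-p (ℕ.s≤s ℕ.z≤n) 2<p))
      (ℤₚ.trans (≡⇒≡ₚ (double a)) (ℤₚ.trans 2a≡2b (≡⇒≡ₚ (≡.sym (double b)))))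
      where
        double : ∀ x → + 2 * x ≡ x + x
        double = solve-∀

    at-most-two-square-roots : ∀ {D xs} → All (ℕ._< p) xs → AllPairs (λ i j → j ℕ.< i) xs →
                               All (λ a → + a * + a ≡ₚ D) xs → length xs ℕ.≤ 2
    at-most-two-square-roots {D} {xs} xs<p decreasing roots = ≡.subst (ℕ._≤ 2) (length-map +_ xs)
      (length-roots≤degree (≢ₚ0-below-p (ℕ.s≤s ℕ.z≤n) (ℕ.nonTrivial⇒n>1 p {{prime⇒nonTrivial isPrime}}))
        (- D ∷ 0ℤ ∷ []) (All.map⁺ (All.map (λ {a} → root {a}) roots))
        (AllPairs.map⁺ (AllPairs-zipWithAll (λ i<p _ j<i → ≢ₚ0⇒cancellable (distinct-below-p j<i i<p ∘ ℤₚ.sym ∘ difference≡ₚ0⇒≡ₚ))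
                                            xs<p decreasing)))
      where
        open MonicPolynomials ℤₚ using (evalMonic; length-roots≤degree)
        quadratic : ∀ x → - D + x * (0ℤ + x * 1ℤ) ≡ x * x - D
        quadratic = solve-∀
        root : ∀ {a} → + a * + a ≡ₚ D → evalMonic (- D ∷ 0ℤ ∷ []) (+ a) ≡ₚ 0ℤ
        root {a} a²≡D = ℤₚ.trans (≡⇒≡ₚ (quadratic (+ a))) (ℤₚ.trans (ℤₚ.+-congʳ a²≡D) (ℤₚ.-‿inverseʳ D))

    module _ {h} (p≡1+2h : p ≡ suc (h ℕ.+ h)) where

      open import Relation.Binary.Reasoning.Setoid ℤₚ.setoid

      half-power-squared≡1 : ∀ {a} → a ≢ₚ 0ℤ → a ^ h * a ^ h ≡ₚ 1ℤ
      half-power-squared≡1 {a} a≢0 = ℤₚ.trans (ℤₚ.sym (^-homo-* a h h)) (fermat-nonzero p≡1+2h a≢0)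

      half-power-invariant : ∀ {a e} → e ≢ₚ 0ℤ → (a * (e * e)) ^ h ≡ₚ a ^ h
      half-power-invariant {a} {e} e≢0 = begin
        (a * (e * e)) ^ h          ≈⟨ ^-distrib-* a (e * e) h ⟩
        a ^ h * (e * e) ^ h        ≈⟨ ℤₚ.*-congˡ {a ^ h} (^-distrib-* e e h) ⟩
        a ^ h * (e ^ h * e ^ h)    ≈⟨ ℤₚ.*-congˡ {a ^ h} (half-power-squared≡1 e≢0) ⟩
        a ^ h * 1ℤ                 ≈⟨ ℤₚ.*-identityʳ (a ^ h) ⟩
        a ^ h                      ∎

      residue⇒half-power≡1 : ∀ {D s} → D ≢ₚ 0ℤ → s * s ≡ₚ D → D ^ h ≡ₚ 1ℤ
      residue⇒half-power≡1 {D} {s} D≢0 s²≡D = begin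
        D ^ h                      ≈⟨ ^-congˡ h (ℤₚ.trans (ℤₚ.sym s²≡D) (ℤₚ.sym (ℤₚ.*-identityˡ (s * s)))) ⟩
        (1ℤ * (s * s)) ^ h         ≈⟨ half-power-invariant s≢0 ⟩
        1ℤ ^ h                     ≈⟨ ExpAndCancellation.1#^n≈1# ℤₚ h ⟩
        1ℤ                         ∎
        where
          s≢0 : s ≢ₚ 0ℤ
          s≢0 s≡0 = D≢0 (ℤₚ.trans (ℤₚ.sym s²≡D) (ℤₚ.trans (ℤₚ.*-congʳ s≡0) (ℤₚ.zeroˡ s)))

module QuadraticExtension {c ℓ} (R : CommutativeRing c ℓ) (D : CommutativeRing.Carrier R) where

  open CommutativeRing R
  open IntegerCoefficientSolver R
  open FromInteger R using (fromℤ)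
  open ExpAndCancellation R using (Cancellable)
  open import Relation.Binary.Reasoning.MultiSetoid

  infix  4 _≈ᵠ_
  infix  5 _+√D·_
  infixl 6 _+ᵠ_
  infixl 7 _*ᵠ_
  infix  8 -ᵠ_

  record Quadratic : Set c where
    constructor _+√D·_
    field
      re im : Carrier
  open Quadratic public

  record _≈ᵠ_ (x y : Quadratic) : Set ℓ where
    constructor _&_
    field
      re≈ : re x ≈ re y
      im≈ : im x ≈ im y
  open _≈ᵠ_ public

  ι : Carrier → Quadratic
  ι a = a +√D· 0#

  √D : Quadratic
  √D = 0# +√D· 1#

  norm : Quadratic → Carrier
  norm (a +√D· b) = a * a - D * (b * b)

  trace : Quadratic → Carrier
  trace x = re x + re x

  -- Opaque, so that implicit arguments of congruence lemmas can be inferred through these operations.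
  opaque
    _+ᵠ_ _*ᵠ_ : Quadratic → Quadratic → Quadratic
    (a +√D· b) +ᵠ (c +√D· d) = (a + c) +√D· (b + d)
    (a +√D· b) *ᵠ (c +√D· d) = (a * c + D * (b * d)) +√D· (a * d + b * c)

    -ᵠ_ conj : Quadratic → Quadratic
    -ᵠ (a +√D· b) = (- a) +√D· (- b)
    conj (a +√D· b) = a +√D· (- b)

  private
    ≈ᵠ-isEquivalence : IsEquivalence _≈ᵠ_
    ≈ᵠ-isEquivalence = record
      { refl  = refl & refl
      ; sym   = λ (r & i) → sym r & sym i
      ; trans = λ (r & i) (r′ & i′) → trans r r′ & trans i i′
      }

    ≈ᵠ-trans : ∀ {x y z} → x ≈ᵠ y → y ≈ᵠ z → x ≈ᵠ z
    ≈ᵠ-trans = IsEquivalence.trans ≈ᵠ-isEquivalence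

  opaque
    unfolding _+ᵠ_ _*ᵠ_ -ᵠ_ conj

    private
      +ᵠ-cong : ∀ {x y u v} → x ≈ᵠ y → u ≈ᵠ v → x +ᵠ u ≈ᵠ y +ᵠ v
      +ᵠ-cong (r & i) (r′ & i′) = +-cong r r′ & +-cong i i′

      +ᵠ-assoc : ∀ x y z → (x +ᵠ y) +ᵠ z ≈ᵠ x +ᵠ (y +ᵠ z)
      +ᵠ-assoc (a +√D· b) (c +√D· d) (e +√D· f) = +-assoc a c e & +-assoc b d f

      +ᵠ-comm : ∀ x y → x +ᵠ y ≈ᵠ y +ᵠ x
      +ᵠ-comm (a +√D· b) (c +√D· d) = +-comm a c & +-comm b d

      +ᵠ-identityˡ : ∀ x → ι 0# +ᵠ x ≈ᵠ x
      +ᵠ-identityˡ (a +√D· b) = +-identityˡ a & +-identityˡ b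

      +ᵠ-identityʳ : ∀ x → x +ᵠ ι 0# ≈ᵠ x
      +ᵠ-identityʳ (a +√D· b) = +-identityʳ a & +-identityʳ b

      -ᵠ-inverseˡ : ∀ x → -ᵠ x +ᵠ x ≈ᵠ ι 0#
      -ᵠ-inverseˡ (a +√D· b) = -‿inverseˡ a & -‿inverseˡ b

      -ᵠ-inverseʳ : ∀ x → x +ᵠ -ᵠ x ≈ᵠ ι 0#
      -ᵠ-inverseʳ (a +√D· b) = -‿inverseʳ a & -‿inverseʳ b

      -ᵠ-cong : ∀ {x y} → x ≈ᵠ y → -ᵠ x ≈ᵠ -ᵠ y
      -ᵠ-cong (r & i) = -‿cong r & -‿cong i

      *ᵠ-cong : ∀ {x y u v} → x ≈ᵠ y → u ≈ᵠ v → x *ᵠ u ≈ᵠ y *ᵠ v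
      *ᵠ-cong (r & i) (r′ & i′) = +-cong (*-cong r r′) (*-congˡ (*-cong i i′)) & +-cong (*-cong r i′) (*-cong i r′)

      *ᵠ-assoc : ∀ x y z → (x *ᵠ y) *ᵠ z ≈ᵠ x *ᵠ (y *ᵠ z)
      *ᵠ-assoc (a +√D· b) (c +√D· d) (e +√D· f) =
        solve 7 (λ D a b c d e f → (a :* c :+ D :* (b :* d)) :* e :+ D :* ((a :* d :+ b :* c) :* f)
                                := a :* (c :* e :+ D :* (d :* f)) :+ D :* (b :* (c :* f :+ d :* e))) refl D a b c d e f
        & solve 7 (λ D a b c d e f → (a :* c :+ D :* (b :* d)) :* f :+ (a :* d :+ b :* c) :* e
                                := a :* (c :* f :+ d :* e) :+ b :* (c :* e :+ D :* (d :* f))) refl D a b c d e f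

      *ᵠ-comm : ∀ x y → x *ᵠ y ≈ᵠ y *ᵠ x
      *ᵠ-comm (a +√D· b) (c +√D· d) =
        solve 5 (λ D a b c d → a :* c :+ D :* (b :* d) := c :* a :+ D :* (d :* b)) refl D a b c d
        & solve 4 (λ a b c d → a :* d :+ b :* c := c :* b :+ d :* a) refl a b c d

      *ᵠ-identityˡ : ∀ x → ι 1# *ᵠ x ≈ᵠ x
      *ᵠ-identityˡ (a +√D· b) =
        solve 3 (λ D a b → con 1ℤ :* a :+ D :* (con 0ℤ :* b) := a) refl D a b
        & solve 2 (λ a b → con 1ℤ :* b :+ con 0ℤ :* a := b) refl a b

      *ᵠ-distribʳ : ∀ x y z → (y +ᵠ z) *ᵠ x ≈ᵠ y *ᵠ x +ᵠ z *ᵠ x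
      *ᵠ-distribʳ (a +√D· b) (c +√D· d) (e +√D· f) =
        solve 7 (λ D a b c d e f → (c :+ e) :* a :+ D :* ((d :+ f) :* b)
                                := (c :* a :+ D :* (d :* b)) :+ (e :* a :+ D :* (f :* b))) refl D a b c d e f
        & solve 6 (λ a b c d e f → (c :+ e) :* b :+ (d :+ f) :* a
                                := (c :* b :+ d :* a) :+ (e :* b :+ f :* a)) refl a b c d e f

  R[√D] : CommutativeRing c ℓ
  R[√D] = record
    { Carrier = Quadratic
    ; _≈_ = _≈ᵠ_
    ; _+_ = _+ᵠ_
    ; _*_ = _*ᵠ_
    ; -_ = -ᵠ_
    ; 0# = ι 0#
    ; 1# = ι 1#
    ; isCommutativeRing = record
      { isRing = record
        { +-isAbelianGroup = record
          { isGroup = record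
            { isMonoid = record
              { isSemigroup = record
                { isMagma = record { isEquivalence = ≈ᵠ-isEquivalence ; ∙-cong = +ᵠ-cong }
                ; assoc = +ᵠ-assoc
                }
              ; identity = +ᵠ-identityˡ , +ᵠ-identityʳ
              }
            ; inverse = -ᵠ-inverseˡ , -ᵠ-inverseʳ
            ; ⁻¹-cong = -ᵠ-cong
            }
          ; comm = +ᵠ-comm
          }
        ; *-cong = *ᵠ-cong
        ; *-assoc = *ᵠ-assoc
        ; *-identity = *ᵠ-identityˡ , (λ x → ≈ᵠ-trans (*ᵠ-comm x (ι 1#)) (*ᵠ-identityˡ x))
        ; distrib = (λ x y z → ≈ᵠ-trans (*ᵠ-comm x (y +ᵠ z)) (≈ᵠ-trans (*ᵠ-distribʳ x y z) (+ᵠ-cong (*ᵠ-comm y x) (*ᵠ-comm z x))))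
                  , *ᵠ-distribʳ
        }
      ; *-comm = *ᵠ-comm
      }
    }

  ι-cong : ∀ {a b} → a ≈ b → ι a ≈ᵠ ι b
  ι-cong a≈b = a≈b & refl

  opaque
    unfolding _+ᵠ_ _*ᵠ_ -ᵠ_ conj

    ι-+ : ∀ a b → ι (a + b) ≈ᵠ ι a +ᵠ ι b
    ι-+ a b = refl & sym (+-identityʳ 0#)

    ι-* : ∀ a b → ι (a * b) ≈ᵠ ι a *ᵠ ι b
    ι-* a b = solve 3 (λ D a b → a :* b := a :* b :+ D :* (con 0ℤ :* con 0ℤ)) refl D a b
            & solve 2 (λ a b → con 0ℤ := a :* con 0ℤ :+ con 0ℤ :* b) refl a b

    ι-neg : ∀ a → ι (- a) ≈ᵠ -ᵠ ι a
    ι-neg a = refl & solve 0 (con 0ℤ := :- con 0ℤ) refl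

    conj-cong : ∀ {x y} → x ≈ᵠ y → conj x ≈ᵠ conj y
    conj-cong (r & i) = r & -‿cong i

    conj-* : ∀ x y → conj (x *ᵠ y) ≈ᵠ conj x *ᵠ conj y
    conj-* (a +√D· b) (c +√D· d) =
      solve 5 (λ D a b c d → a :* c :+ D :* (b :* d) := a :* c :+ D :* ((:- b) :* (:- d))) refl D a b c d
      & solve 4 (λ a b c d → :- (a :* d :+ b :* c) := a :* (:- d) :+ (:- b) :* c) refl a b c d

    conj-ι : ∀ a → conj (ι a) ≈ᵠ ι a
    conj-ι a = refl & solve 0 (:- con 0ℤ := con 0ℤ) refl

    *-conj : ∀ x → x *ᵠ conj x ≈ᵠ ι (norm x)
    *-conj (a +√D· b) = solve 3 (λ D a b → a :* a :+ D :* (b :* (:- b)) := a :* a :- D :* (b :* b)) refl D a b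
                      & solve 2 (λ a b → a :* (:- b) :+ b :* a := con 0ℤ) refl a b

    +-conj : ∀ x → x +ᵠ conj x ≈ᵠ ι (trace x)
    +-conj (a +√D· b) = refl & -‿inverseʳ b

    norm-* : ∀ x y → norm (x *ᵠ y) ≈ norm x * norm y
    norm-* (a +√D· b) (c +√D· d) = solve 5
      (λ D a b c d → (a :* c :+ D :* (b :* d)) :* (a :* c :+ D :* (b :* d)) :- D :* ((a :* d :+ b :* c) :* (a :* d :+ b :* c))
                   := (a :* a :- D :* (b :* b)) :* (c :* c :- D :* (d :* d))) refl D a b c d

    √D*√D : √D *ᵠ √D ≈ᵠ ι D
    √D*√D = solve 1 (λ D → con 0ℤ :* con 0ℤ :+ D :* (con 1ℤ :* con 1ℤ) := D) refl D
          & solve 0 (con 0ℤ :* con 1ℤ :+ con 1ℤ :* con 0ℤ := con 0ℤ) refl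

    re+im√D : ∀ x → x ≈ᵠ ι (re x) +ᵠ ι (im x) *ᵠ √D
    re+im√D (a +√D· b) = solve 3 (λ D a b → a := a :+ (b :* con 0ℤ :+ D :* (con 0ℤ :* con 1ℤ))) refl D a b
                       & solve 2 (λ a b → b := con 0ℤ :+ (b :* con 1ℤ :+ con 0ℤ :* con 0ℤ)) refl a b

    ι-cancellable : ∀ {a} → Cancellable a → ExpAndCancellation.Cancellable R[√D] (ι a)
    ι-cancellable {a} cancel (b +√D· c) (r & i) =
      cancel b (trans (solve 4 (λ D a b c → b :* a := b :* a :+ D :* (c :* con 0ℤ)) refl D a b c) r)
      & cancel c (trans (solve 3 (λ a b c → c :* a := b :* con 0ℤ :+ c :* a) refl a b c) i)

  module ᵠ = CommutativeRing R[√D]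

  norm-cancellable : ∀ {x} → Cancellable (norm x) → ExpAndCancellation.Cancellable R[√D] x
  norm-cancellable {x} cancel y y*x≈0 = ι-cancellable cancel y (begin⟨ ᵠ.setoid ⟩
    y *ᵠ ι (norm x)        ≈⟨ ᵠ.*-congˡ (*-conj x) ⟨
    y *ᵠ (x *ᵠ conj x)     ≈⟨ ᵠ.*-assoc y x (conj x) ⟨
    y *ᵠ x *ᵠ conj x       ≈⟨ ᵠ.*-congʳ y*x≈0 ⟩
    ι 0# *ᵠ conj x         ≈⟨ ᵠ.zeroˡ (conj x) ⟩
    ι 0#                   ∎)

  norm-ι : ∀ a → norm (ι a) ≈ a * a
  norm-ι a = solve 2 (λ D a → a :* a :- D :* (con 0ℤ :* con 0ℤ) := a :* a) refl D a

  trace²-4norm : ∀ x → trace x * trace x - fromℤ (+ 4) * norm x ≈ D * ((im x + im x) * (im x + im x))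
  trace²-4norm (a +√D· b) = solve 3
    (λ D a b → (a :+ a) :* (a :+ a) :- con (+ 4) :* (a :* a :- D :* (b :* b)) := D :* ((b :+ b) :* (b :+ b))) refl D a b

  opaque
    unfolding _+ᵠ_ -ᵠ_ conj

    conj-components : ∀ x → conj x ≈ᵠ re x +√D· (- im x)
    conj-components (a +√D· b) = refl & refl

    norm-conj : ∀ x → norm (conj x) ≈ norm x
    norm-conj (a +√D· b) = solve 3 (λ D a b → a :* a :- D :* ((:- b) :* (:- b)) := a :* a :- D :* (b :* b)) refl D a b

    im[x*conj[y]] : ∀ x y → im (x *ᵠ conj y) ≈ im x * re y - re x * im y
    im[x*conj[y]] (a +√D· b) (c +√D· d) = solve 4 (λ a b c d → a :* (:- d) :+ b :* c := b :* c :- a :* d) refl a b c d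

    norm[x-y] : ∀ x y → norm (x +ᵠ -ᵠ y) ≈ norm x + norm y - trace (x *ᵠ conj y)
    norm[x-y] (a +√D· b) (c +√D· d) = solve 5
      (λ D a b c d → (a :- c) :* (a :- c) :- D :* ((b :- d) :* (b :- d))
                   := (a :* a :- D :* (b :* b)) :+ (c :* c :- D :* (d :* d))
                      :- ((a :* c :+ D :* (b :* (:- d))) :+ (a :* c :+ D :* (b :* (:- d))))) refl D a b c d

    norm[ι-√D] : ∀ a → norm (ι a +ᵠ -ᵠ √D) ≈ a * a - D
    norm[ι-√D] a = solve 2
      (λ D a → (a :- con 0ℤ) :* (a :- con 0ℤ) :- D :* ((con 0ℤ :- con 1ℤ) :* (con 0ℤ :- con 1ℤ)) := a :* a :- D) refl D a

    norm[x-conj[x]] : ∀ x → norm (x +ᵠ -ᵠ conj x) ≈ - (D * ((im x + im x) * (im x + im x)))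
    norm[x-conj[x]] (a +√D· b) = solve 3
      (λ D a b → (a :- a) :* (a :- a) :- D :* ((b :- :- b) :* (b :- :- b)) := :- (D :* ((b :+ b) :* (b :+ b)))) refl D a b

  private
    module Fᵠ = FromInteger R[√D]
    module F = FromInteger R

    fromℤ-ι-ℕ : ∀ n → Fᵠ.fromℤ (+ n) ≈ᵠ ι (fromℤ (+ n))
    fromℤ-ι-ℕ zero    = ᵠ.refl
    fromℤ-ι-ℕ (suc n) = begin⟨ ᵠ.setoid ⟩
      Fᵠ.fromℤ (1ℤ ℤ.+ + n)           ≈⟨ Fᵠ.fromℤ-+ 1ℤ (+ n) ⟩
      ι 1# +ᵠ Fᵠ.fromℤ (+ n)          ≈⟨ ᵠ.+-congˡ (fromℤ-ι-ℕ n) ⟩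
      ι 1# +ᵠ ι (fromℤ (+ n))         ≈⟨ ι-+ 1# _ ⟨
      ι (1# + fromℤ (+ n))            ≈⟨ ι-cong (F.fromℤ-+ 1ℤ (+ n)) ⟨
      ι (fromℤ (+ suc n))             ∎

  fromℤ-ι : ∀ i → Fᵠ.fromℤ i ≈ᵠ ι (fromℤ i)
  fromℤ-ι (+ n)    = fromℤ-ι-ℕ n
  fromℤ-ι -[1+ n ] = begin⟨ ᵠ.setoid ⟩
    Fᵠ.fromℤ -[1+ n ]            ≈⟨ Fᵠ.fromℤ-neg (+ suc n) ⟩
    -ᵠ Fᵠ.fromℤ (+ suc n)        ≈⟨ ᵠ.-‿cong (fromℤ-ι-ℕ (suc n)) ⟩
    -ᵠ ι (fromℤ (+ suc n))       ≈⟨ ι-neg _ ⟨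
    ι (- fromℤ (+ suc n))        ≈⟨ ι-cong (F.fromℤ-neg (+ suc n)) ⟨
    ι (fromℤ -[1+ n ])           ∎

module QuadraticExtensionModulo {p h : ℕ} (isPrime : Prime p) (p≡1+2h : p ≡ suc (h ℕ.+ h)) (D : ℤ) where

  open import Data.Product using (_×_)
  open IntegersModulo p
  open QuadraticExtension ℤₚ D public
  open CommutativeRing R[√D]
  open FromInteger R[√D] using (fromℤ; fromℤ-+)
  open ExpAndCancellation R[√D]
  open ExpAndCancellation ℤₚ using () renaming (_^_ to _^ₚ_; Cancellable-^ to Cancellable-^ₚ)
  open MonicPolynomials R[√D]
  open IntegerCoefficientSolver R[√D]
  open import Relation.Binary.Reasoning.MultiSetoid

  ι-^ : ∀ a n → ι a ^ n ≈ ι (a ^ₚ n)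
  ι-^ a zero    = refl
  ι-^ a (suc n) = trans (*-congˡ (ι-^ a n)) (sym (ι-* a _))

  private
    characteristic : fromℤ (+ p) ≈ 0#
    characteristic = trans (fromℤ-ι (+ p)) (ι-cong (ℤₚ.trans (fromℤ≡ₚ (+ p)) p≡ₚ0))

  freshman's-dream : ∀ x y → (x + y) ^ p ≈ x ^ p + y ^ p
  freshman's-dream = CharacteristicPrime.freshman's-dream R[√D] isPrime characteristic

  ι-fermat : ∀ a → ι a ^ p ≈ ι a
  ι-fermat a = trans (ι-^ a p) (ι-cong (fermat isPrime a))

  √D^p : √D ^ p ≈ √D * ι (D ^ₚ h)
  √D^p = begin⟨ setoid ⟩
    √D ^ p                  ≈⟨ reflexive (≡.cong (√D ^_) p≡1+2h) ⟩
    √D * √D ^ (h ℕ.+ h)     ≈⟨ *-congˡ (^-homo-* √D h h) ⟩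
    √D * (√D ^ h * √D ^ h)  ≈⟨ *-congˡ (^-distrib-* √D √D h) ⟨
    √D * (√D * √D) ^ h      ≈⟨ *-congˡ (trans (^-congˡ h √D*√D) (ι-^ D h)) ⟩
    √D * ι (D ^ₚ h)         ∎

  frobenius : ∀ {e} → D ^ₚ h ≡ₚ e → ∀ x → x ^ p ≈ re x +√D· (im x ℤ.* e)
  frobenius {e} Dʰ≡e x = begin⟨ setoid ⟩
    x ^ p                          ≈⟨ ^-congˡ p (re+im√D x) ⟩
    (ι a + ι b * √D) ^ p           ≈⟨ freshman's-dream (ι a) (ι b * √D) ⟩
    ι a ^ p + (ι b * √D) ^ p       ≈⟨ +-cong (ι-fermat a) (^-distrib-* (ι b) √D p) ⟩
    ι a + ι b ^ p * √D ^ p         ≈⟨ +-congˡ (*-cong (ι-fermat b) (trans √D^p (*-congˡ (ι-cong Dʰ≡e)))) ⟩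
    ι a + ι b * (√D * ι e)         ≈⟨ +-congˡ (solve 3 (λ b t e → b :* (t :* e) := b :* e :* t) refl (ι b) √D (ι e)) ⟩
    ι a + ι b * ι e * √D           ≈⟨ +-congˡ (*-congʳ (ι-* b e)) ⟨
    ι a + ι (b ℤ.* e) * √D         ≈⟨ re+im√D (a +√D· (b ℤ.* e)) ⟨
    a +√D· (b ℤ.* e)               ∎
    where
      a = re x
      b = im x

  frobenius-residue : D ^ₚ h ≡ₚ 1ℤ → ∀ x → x ^ p ≈ x
  frobenius-residue Dʰ≡1 x = trans (frobenius Dʰ≡1 x) (ℤₚ.refl & ≡⇒≡ₚ (ℤ.*-identityʳ (im x)))

  frobenius-nonresidue : D ^ₚ h ≡ₚ -1ℤ → ∀ x → x ^ p ≈ conj x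
  frobenius-nonresidue Dʰ≡-1 x = trans (frobenius Dʰ≡-1 x) (sym (trans (conj-components x) (ℤₚ.refl & ≡⇒≡ₚ (-i≡i*-1 (im x)))))
    where
      -i≡i*-1 : ∀ i → ℤ.- i ≡ i ℤ.* -1ℤ
      -i≡i*-1 = solve-∀

  private
    1<p : 1 ℕ.< p
    1<p = ℕ.nonTrivial⇒n>1 p {{prime⇒nonTrivial isPrime}}

    1≉0 : 1# ≉ 0#
    1≉0 (1≡ₚ0 & _) = ≢ₚ0-below-p (ℕ.s≤s ℕ.z≤n) 1<p 1≡ₚ0

    p-2 : ℕ
    p-2 = p ℕ.∸ 2

    p≡2+[p-2] : p ≡ suc (suc p-2)
    p≡2+[p-2] = ≡.sym (ℕ.m+[n∸m]≡n 1<p)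

    -- The monic polynomial Xᵖ − X in the encoding of evalMonic.
    fermatPolynomial : List Quadratic
    fermatPolynomial = 0# ∷ - 1# ∷ replicate p-2 0#

    fixed⇒fermatPolynomial-root : ∀ {x} → x ^ p ≈ x → evalMonic fermatPolynomial x ≈ 0#
    fixed⇒fermatPolynomial-root {x} x^p≈x = begin⟨ setoid ⟩
      0# + x * (- 1# + x * evalMonic (replicate p-2 0#) x) ≈⟨ +-congˡ (*-congˡ (+-congˡ (*-congˡ (evalMonic-monomial p-2 x)))) ⟩
      0# + x * (- 1# + x * x ^ p-2)                        ≈⟨ solve 2 (λ x y → con 0ℤ :+ x :* (:- con 1ℤ :+ x :* y) := x :* (x :* y) :- x) refl x (x ^ p-2) ⟩
      x ^ suc (suc p-2) - x                                ≈⟨ reflexive (≡.cong (λ n → x ^ n - x) p≡2+[p-2]) ⟨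
      x ^ p - x                                            ≈⟨ +-congʳ x^p≈x ⟩
      x - x                                                ≈⟨ -‿inverseʳ x ⟩
      0#                                                   ∎

    ι-difference : ∀ a b → ι (a ℤ.- b) ≈ ι a - ι b
    ι-difference a b = trans (ι-+ a (ℤ.- b)) (+-congˡ (ι-neg b))

  ι-difference-cancellable : ∀ {a b} → a ≢ₚ b → Cancellable (ι a - ι b)
  ι-difference-cancellable {a} {b} a≢b =
    Cancellable-resp-≈ (ι-difference a b) (ι-cancellable (≢ₚ0⇒cancellable isPrime (a≢b ∘ difference≡ₚ0⇒≡ₚ)))

  -- If Dʰ = 1 then √D is fixed by Frobenius, so Xᵖ − X would have the p + 1 roots 0, …, p − 1, √D.
  nonresidue⇒Dʰ≢1 : (∀ s → s ℤ.* s ≢ₚ D) → D ^ₚ h ≢ₚ 1ℤ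
  nonresidue⇒Dʰ≢1 nonresidue Dʰ≡1 = ℕ.<-irrefl ≡.refl
    (≡.subst₂ ℕ._≤_ (≡.cong suc (length-applyDownFrom residue p))
                    (≡.trans (≡.cong (suc ∘ suc) (length-replicate p-2)) (≡.sym p≡2+[p-2]))
      (length-roots≤degree 1≉0 fermatPolynomial
        (fixed⇒fermatPolynomial-root √D-fixed ∷ All.applyDownFrom⁺₂ residue p (λ a → fixed⇒fermatPolynomial-root (ι-fermat (+ a))))
        (All.applyDownFrom⁺₂ residue p (λ a → norm-cancellable (≢ₚ0⇒cancellable isPrime (a²≢D a)))
          ∷ AllPairs.applyDownFrom⁺₁ residue p (λ j<i i<p → ι-difference-cancellable (distinct-below-p j<i i<p ∘ ℤₚ.sym)))))
    where
      residue : ℕ → Quadratic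
      residue a = ι (+ a)
      √D-fixed : √D ^ p ≈ √D
      √D-fixed = trans √D^p (trans (*-congˡ (ι-cong Dʰ≡1)) (*-identityʳ √D))
      a²≢D : ∀ a → norm (residue a - √D) ≢ₚ 0ℤ
      a²≢D a a²-D≡0 = nonresidue (+ a) (difference≡ₚ0⇒≡ₚ (ℤₚ.trans (ℤₚ.sym (norm[ι-√D] (+ a))) a²-D≡0))

  private
    nonresidue⇒Dʰ≡-1 : D ≢ₚ 0ℤ → (∀ s → s ℤ.* s ≢ₚ D) → D ^ₚ h ≡ₚ -1ℤ
    nonresidue⇒Dʰ≡-1 D≢0 nonresidue with square≡1⇒≡±1 isPrime (half-power-squared≡1 isPrime {h} p≡1+2h D≢0)
    ... | inj₁ Dʰ≡1  = contradiction Dʰ≡1 (nonresidue⇒Dʰ≢1 nonresidue)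
    ... | inj₂ Dʰ≡-1 = Dʰ≡-1

  data QuadraticCharacter : ℤ → Set where
    residue    : D ^ₚ h ≡ₚ 1ℤ  → QuadraticCharacter 1ℤ
    nonresidue : D ^ₚ h ≡ₚ -1ℤ → QuadraticCharacter -1ℤ

  euler-criterion : D ≢ₚ 0ℤ → QuadraticCharacter (legendre D p)
  euler-criterion D≢0 with + p ℤ.∣? D
  ... | yes p∣D = contradiction (∣⇒≡ₚ0 p∣D) D≢0
  ... | no _ with any? (λ x → + p ℤ.∣? (x ℤ.* x ℤ.- D)) (map +_ (upTo p))
  ...   | yes square = let s , p∣s²-D = Any.satisfied square in residue (residue⇒half-power≡1 isPrime {h} p≡1+2h {s = s} D≢0 (∣⇒≡ₚ p∣s²-D))
  ...   | no nonsquare = nonresidue (nonresidue⇒Dʰ≡-1 D≢0 reduced-nonresidue)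
    where
      instance
        p≢0 : ℕ.NonZero p
        p≢0 = prime⇒nonZero isPrime
      reduced-nonresidue : ∀ s → s ℤ.* s ≢ₚ D
      reduced-nonresidue s s²≡D = nonsquare (Any.map (λ { ≡.refl → ≡ₚ⇒∣ r²≡D })
        (∈-map⁺ +_ (∈-upTo⁺ (ℤ.n%ℕd<d s p))))
        where
          r²≡D : + (s ℤ.%ℕ p) ℤ.* + (s ℤ.%ℕ p) ≡ₚ D
          r²≡D = ℤₚ.trans (ℤₚ.*-cong (ℤₚ.sym (s≡ₚs%p isPrime s)) (ℤₚ.sym (s≡ₚs%p isPrime s))) s²≡D

  _≟ᵠ_ : Decidable _≈_
  x ≟ᵠ y with re x ≟ₚ re y | im x ≟ₚ im y
  ... | yes r≡ | yes i≡ = yes (r≡ & i≡)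
  ... | no r≢  | _      = no (r≢ ∘ re≈)
  ... | yes _  | no i≢  = no (i≢ ∘ im≈)

  private
    2<p : 2 ℕ.< p
    2<p = odd-prime⇒2<p {h = h} isPrime p≡1+2h

  NormOne : Quadratic → Set
  NormOne x = norm x ≡ₚ 1ℤ

  NormOne-* : ∀ {x y} → NormOne x → NormOne y → NormOne (x * y)
  NormOne-* {x} {y} Nx≡1 Ny≡1 = ℤₚ.trans (norm-* x y) (ℤₚ.trans (ℤₚ.*-cong Nx≡1 Ny≡1) (≡⇒≡ₚ ≡.refl))

  NormOne-^ : ∀ {x} → NormOne x → ∀ n → NormOne (x ^ n)
  NormOne-^ Nx≡1 zero    = norm-ι 1ℤ
  NormOne-^ Nx≡1 (suc n) = NormOne-* Nx≡1 (NormOne-^ Nx≡1 n)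

  NormOne-conj : ∀ {x} → NormOne x → NormOne (conj x)
  NormOne-conj {x} = ℤₚ.trans (norm-conj x)

  NormOne⇒x*conj[x]≈1 : ∀ {x} → NormOne x → x * conj x ≈ 1#
  NormOne⇒x*conj[x]≈1 {x} Nx≡1 = trans (*-conj x) (ι-cong Nx≡1)

  module NormOneGroup (D≢0 : D ≢ₚ 0ℤ) where

    order : ℤ → ℕ
    order ε = ℤ.∣ + p ℤ.- ε ∣

    order≢0 : ∀ {ε} → QuadraticCharacter ε → ℕ.NonZero (order ε)
    order≢0 (residue _)    = ℕ.>-nonZero (≡.subst (0 ℕ.<_) (≡.cong (λ q → ℤ.∣ + q ℤ.- 1ℤ ∣) (ℕ.suc-pred p))
                                                 (ℕ.<-≤-trans (ℕ.s≤s ℕ.z≤n) (ℕ.pred-mono-≤ 2<p)))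
      where instance _ = prime⇒nonZero isPrime
    order≢0 (nonresidue _) = ℕ.>-nonZero (ℕ.m≤n+m 1 p)

    ^order≈1 : ∀ {ε} → QuadraticCharacter ε → ∀ {x} → NormOne x → x ^ order ε ≈ 1#
    ^order≈1 (residue Dʰ≡1) {x} Nx≡1 = ≡.subst (λ n → x ^ n ≈ 1#) (≡.sym order≡2h) (begin⟨ setoid ⟩
      x ^ (h ℕ.+ h)                      ≈⟨ *-identityʳ _ ⟨
      x ^ (h ℕ.+ h) * 1#                 ≈⟨ *-congˡ (NormOne⇒x*conj[x]≈1 Nx≡1) ⟨
      x ^ (h ℕ.+ h) * (x * conj x)       ≈⟨ solve 3 (λ y x c → y :* (x :* c) := x :* y :* c) refl (x ^ (h ℕ.+ h)) x (conj x) ⟩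
      x * x ^ (h ℕ.+ h) * conj x         ≈⟨ reflexive (≡.cong (λ n → x ^ n * conj x) p≡1+2h) ⟨
      x ^ p * conj x                     ≈⟨ *-congʳ (frobenius-residue Dʰ≡1 x) ⟩
      x * conj x                         ≈⟨ NormOne⇒x*conj[x]≈1 Nx≡1 ⟩
      1#                                 ∎)
      where
        order≡2h : order 1ℤ ≡ h ℕ.+ h
        order≡2h = ≡.cong (λ q → ℤ.∣ + q ℤ.- 1ℤ ∣) p≡1+2h
    ^order≈1 (nonresidue Dʰ≡-1) {x} Nx≡1 = ≡.subst (λ n → x ^ n ≈ 1#) (≡.sym (ℕ.+-comm p 1)) (begin⟨ setoid ⟩
      x * x ^ p                          ≈⟨ *-congˡ (frobenius-nonresidue Dʰ≡-1 x) ⟩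
      x * conj x                         ≈⟨ NormOne⇒x*conj[x]≈1 Nx≡1 ⟩
      1#                                 ∎)

    -- If norm (x − y) = 0 then u = x·ȳ has norm 1 and trace 2, which forces u = 1 since D ≢ 0.
    NormOne-≉⇒cancellable : ∀ {x y} → NormOne x → NormOne y → x ≉ y → Cancellable (x - y)
    NormOne-≉⇒cancellable {x} {y} Nx≡1 Ny≡1 x≉y = norm-cancellable (≢ₚ0⇒cancellable isPrime (x≉y ∘ norm[x-y]≡0⇒x≈y))
      where
        u = x * conj y
        norm[x-y]≡0⇒x≈y : norm (x - y) ≡ₚ 0ℤ → x ≈ y
        norm[x-y]≡0⇒x≈y N[x-y]≡0 = begin⟨ setoid ⟩
          x                  ≈⟨ *-identityʳ x ⟨
          x * 1#             ≈⟨ *-congˡ (NormOne⇒x*conj[x]≈1 Ny≡1) ⟨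
          x * (y * conj y)   ≈⟨ solve 3 (λ x y c → x :* (y :* c) := x :* c :* y) refl x y (conj y) ⟩
          u * y              ≈⟨ *-congʳ u≈1 ⟩
          1# * y             ≈⟨ *-identityˡ y ⟩
          y                  ∎
          where
            Nu≡1 : norm u ≡ₚ 1ℤ
            Nu≡1 = NormOne-* Nx≡1 (NormOne-conj Ny≡1)
            trace[u]≡2 : trace u ≡ₚ 1ℤ ℤ.+ 1ℤ
            trace[u]≡2 = ℤₚ.sym (difference≡ₚ0⇒≡ₚ (begin⟨ ℤₚ.setoid ⟩
              1ℤ ℤ.+ 1ℤ ℤ.- trace u             ≈⟨ ℤₚ.+-congʳ (ℤₚ.+-cong Nx≡1 Ny≡1) ⟨
              norm x ℤ.+ norm y ℤ.- trace u     ≈⟨ norm[x-y] x y ⟨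
              norm (x - y)                      ≈⟨ N[x-y]≡0 ⟩
              0ℤ                                ∎))
            re[u]≡1 : re u ≡ₚ 1ℤ
            re[u]≡1 = double-injective isPrime 2<p trace[u]≡2
            D[2im[u]]²≡0 : D ℤ.* ((im u ℤ.+ im u) ℤ.* (im u ℤ.+ im u)) ≡ₚ 0ℤ
            D[2im[u]]²≡0 = begin⟨ ℤₚ.setoid ⟩
              D ℤ.* ((im u ℤ.+ im u) ℤ.* (im u ℤ.+ im u))       ≈⟨ trace²-4norm u ⟨
              trace u ℤ.* trace u ℤ.- + 4 ℤ.* norm u            ≈⟨ ℤₚ.+-cong (ℤₚ.*-cong trace[u]≡2 trace[u]≡2) (ℤₚ.-‿cong (ℤₚ.*-congˡ {+ 4} Nu≡1)) ⟩
              0ℤ                                                ∎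
            im[u]≡0 : im u ≡ₚ 0ℤ
            im[u]≡0 with product≡ₚ0 isPrime D[2im[u]]²≡0
            ... | inj₁ D≡0   = contradiction D≡0 D≢0
            ... | inj₂ s²≡0 = double-injective isPrime 2<p {im u} {0ℤ} (Sum.reduce (product≡ₚ0 isPrime s²≡0))
            u≈1 : u ≈ 1#
            u≈1 = re[u]≡1 & im[u]≡0

    private
      w : ℕ → Quadratic
      w a = + a +√D· 1ℤ

      Invertible : ℕ → Set
      Invertible a = norm (w a) ≢ₚ 0ℤ

      invertible? : U.Decidable Invertible
      invertible? a = ¬? (norm (w a) ≟ₚ 0ℤ)

      -- g a = (a + √D)/(a − √D), computed as (a + √D)² / norm (a + √D).
      g : ℕ → Quadratic
      g a = w a * w a * ι (inverse isPrime (norm (w a)))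

      g*conj[w]≈w : ∀ {a} → Invertible a → g a * conj (w a) ≈ w a
      g*conj[w]≈w {a} invertible = begin⟨ setoid ⟩
        w a * w a * ι c * conj (w a)    ≈⟨ solve 3 (λ w c k → w :* w :* c :* k := w :* (w :* k) :* c) refl (w a) (ι c) (conj (w a)) ⟩
        w a * (w a * conj (w a)) * ι c  ≈⟨ *-congʳ (*-congˡ (*-conj (w a))) ⟩
        w a * ι (norm (w a)) * ι c      ≈⟨ *-assoc (w a) _ _ ⟩
        w a * (ι (norm (w a)) * ι c)    ≈⟨ *-congˡ (ι-* _ _) ⟨
        w a * ι (norm (w a) ℤ.* c)      ≈⟨ *-congˡ (ι-cong (*-inverse isPrime invertible)) ⟩
        w a * 1#                        ≈⟨ *-identityʳ (w a) ⟩
        w a                             ∎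
        where c = inverse isPrime (norm (w a))

      g-NormOne : ∀ {a} → Invertible a → NormOne (g a)
      g-NormOne {a} invertible = begin⟨ ℤₚ.setoid ⟩
        norm (w a * w a * ι c)               ≈⟨ norm-* (w a * w a) (ι c) ⟩
        norm (w a * w a) ℤ.* norm (ι c)      ≈⟨ ℤₚ.*-cong (norm-* (w a) (w a)) (norm-ι c) ⟩
        (N ℤ.* N) ℤ.* (c ℤ.* c)              ≈⟨ ≡⇒≡ₚ (rearrange N c) ⟩
        (N ℤ.* c) ℤ.* (N ℤ.* c)              ≈⟨ ℤₚ.*-cong (*-inverse isPrime invertible) (*-inverse isPrime invertible) ⟩
        1ℤ                                   ∎
        where
          c = inverse isPrime (norm (w a))
          N = norm (w a)
          rearrange : ∀ x y → (x ℤ.* x) ℤ.* (y ℤ.* y) ≡ (x ℤ.* y) ℤ.* (x ℤ.* y)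
          rearrange = solve-∀

      conj[w]≉w : ∀ a → conj (w a) ≉ w a
      conj[w]≉w a conj[w]≈w = ≢ₚ0-below-p (ℕ.s≤s ℕ.z≤n) 2<p
        (∣⇒≡ₚ0 (≡ₚ⇒∣ (im≈ (trans (sym conj[w]≈w) (conj-components (w a))))))

      g≉1 : ∀ {a} → Invertible a → 1# ≉ g a
      g≉1 {a} invertible 1≈g = conj[w]≉w a (begin⟨ setoid ⟩
        conj (w a)          ≈⟨ *-identityˡ _ ⟨
        1# * conj (w a)     ≈⟨ *-congʳ 1≈g ⟩
        g a * conj (w a)    ≈⟨ g*conj[w]≈w invertible ⟩
        w a                 ∎)

      g-injective : ∀ {a b} → Invertible a → Invertible b → + a ≢ₚ + b → g a ≉ g b
      g-injective {a} {b} invertible-a invertible-b a≢b ga≈gb = a≢b (ℤₚ.sym (difference≡ₚ0⇒≡ₚ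
        (double-injective isPrime 2<p {+ b ℤ.- + a} {0ℤ} (begin⟨ ℤₚ.setoid ⟩
          (+ b ℤ.- + a) ℤ.+ (+ b ℤ.- + a)                   ≈⟨ ≡⇒≡ₚ (antisymmetric-difference (+ a) (+ b)) ⟩
          (1ℤ ℤ.* + b ℤ.- + a ℤ.* 1ℤ) ℤ.- (1ℤ ℤ.* + a ℤ.- + b ℤ.* 1ℤ)
                                                            ≈⟨ ℤₚ.+-congʳ (im[x*conj[y]] (w a) (w b)) ⟨
          im (w a * conj (w b)) ℤ.- (1ℤ ℤ.* + a ℤ.- + b ℤ.* 1ℤ)
                                                            ≈⟨ ℤₚ.+-cong (im≈ swap) (ℤₚ.-‿cong (ℤₚ.sym (im[x*conj[y]] (w b) (w a)))) ⟩
          im (w b * conj (w a)) ℤ.- im (w b * conj (w a))   ≈⟨ ℤₚ.-‿inverseʳ (im (w b * conj (w a))) ⟩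
          0ℤ                                                ∎))))
        where
          antisymmetric-difference : ∀ x y → (y ℤ.- x) ℤ.+ (y ℤ.- x) ≡ (1ℤ ℤ.* y ℤ.- x ℤ.* 1ℤ) ℤ.- (1ℤ ℤ.* x ℤ.- y ℤ.* 1ℤ)
          antisymmetric-difference = solve-∀
          swap : w a * conj (w b) ≈ w b * conj (w a)
          swap = begin⟨ setoid ⟩
            w a * conj (w b)                  ≈⟨ *-congʳ (g*conj[w]≈w invertible-a) ⟨
            g a * conj (w a) * conj (w b)     ≈⟨ *-congʳ (*-congʳ ga≈gb) ⟩
            g b * conj (w a) * conj (w b)     ≈⟨ solve 3 (λ x y z → x :* y :* z := x :* z :* y) refl (g b) (conj (w a)) (conj (w b)) ⟩
            g b * conj (w b) * conj (w a)     ≈⟨ *-congʳ (g*conj[w]≈w invertible-b) ⟩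
            w b * conj (w a)                  ∎

      indices : List ℕ
      indices = filter invertible? (downFrom p)

    elements : List Quadratic
    elements = 1# ∷ map g indices

    elements-NormOne : All NormOne elements
    elements-NormOne = norm-ι 1ℤ ∷ All.map⁺ (All.map g-NormOne (All.all-filter invertible? (downFrom p)))

    elements-distinct : AllPairs _≉_ elements
    elements-distinct =
      All.map⁺ (All.map g≉1 (All.all-filter invertible? (downFrom p)))
      ∷ AllPairs.map⁺ (AllPairs-zipWithAll g-injective (All.all-filter invertible? (downFrom p))
                        (AllPairs.filter⁺ invertible? (AllPairs.applyDownFrom⁺₁ id p distinct-below-p)))

    private
      non-invertible : List ℕ
      non-invertible = filter (∁? invertible?) (downFrom p)

      non-invertible-squares : All (λ a → + a ℤ.* + a ≡ₚ D) non-invertible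
      non-invertible-squares = All.map (λ {a} → square {a}) (All.all-filter (∁? invertible?) (downFrom p))
        where
          square : ∀ {a} → ¬ Invertible a → + a ℤ.* + a ≡ₚ D
          square {a} ¬invertible = difference≡ₚ0⇒≡ₚ (ℤₚ.trans (ℤₚ.+-congˡ {+ a ℤ.* + a} (ℤₚ.-‿cong (≡⇒≡ₚ (≡.sym (ℤ.*-identityʳ D)))))
                                                             (Dec.decidable-stable (norm (w a) ≟ₚ 0ℤ) ¬invertible))

      length-split : length indices ℕ.+ length non-invertible ≡ p
      length-split = ≡.trans (length-filter+length-filter-∁ invertible? (downFrom p)) (length-downFrom p)

      length-elements : length elements ≡ suc (length indices)
      length-elements = ≡.cong suc (length-map g indices)

    order≤length : ∀ {ε} → QuadraticCharacter ε → order ε ℕ.≤ length elements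
    order≤length (residue _) = ≡.subst₂ ℕ._≤_ (≡.cong (λ q → ℤ.∣ + q ℤ.- 1ℤ ∣) (ℕ.suc-pred p)) (≡.sym length-elements)
      (ℕ.pred-mono-≤ (≡.subst₂ ℕ._≤_ length-split (ℕ.+-comm (length indices) 2) (ℕ.+-monoʳ-≤ (length indices) at-most-two)))
      where
        instance _ = prime⇒nonZero isPrime
        at-most-two : length non-invertible ℕ.≤ 2
        at-most-two = at-most-two-square-roots isPrime
          (All.filter⁺ (∁? invertible?) (All.applyDownFrom⁺₁ id p id))
          (AllPairs.filter⁺ (∁? invertible?) (AllPairs.applyDownFrom⁺₁ id p (λ j<i _ → j<i)))
          non-invertible-squares
    order≤length (nonresidue Dʰ≡-1) = ℕ.≤-reflexive (≡.trans (ℕ.+-comm p 1) (≡.trans (≡.cong suc (≡.sym all-invertible)) (≡.sym length-elements)))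
      where
        1≢-1 : 1ℤ ≢ₚ -1ℤ
        1≢-1 1≡-1 = ≢ₚ0-below-p (ℕ.s≤s ℕ.z≤n) 2<p (∣⇒≡ₚ0 (≡ₚ⇒∣ 1≡-1))
        none : ∀ {xs} → All (λ a → + a ℤ.* + a ≡ₚ D) xs → length xs ≡ 0
        none []                 = ≡.refl
        none {a ∷ _} (a²≡D ∷ _) = contradiction (ℤₚ.trans (ℤₚ.sym (residue⇒half-power≡1 isPrime {h} p≡1+2h {s = + a} D≢0 a²≡D)) Dʰ≡-1) 1≢-1
        all-invertible : length indices ≡ p
        all-invertible = ≡.trans (≡.sym (ℕ.+-identityʳ _)) (≡.trans (≡.cong (length indices ℕ.+_) (≡.sym (none non-invertible-squares))) length-split)

    nth-power⇔ : ∀ {ε} (χ : QuadraticCharacter ε) {n k} → k ℕ.* gcd n (order ε) ≡ order ε → ∀ {γ} → NormOne γ →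
                 (∃[ α ] (NormOne α × α ^ n ≈ γ)) ⇔ γ ^ k ≈ 1#
    nth-power⇔ {ε} χ {n} {k} = PowerMapOnSubgroup.nth-power⇔ R[√D] {G = NormOne} (λ {x} → NormOne-^ {x})
      (λ {x} Nx≡1 → conj x , NormOne-conj Nx≡1 , NormOne⇒x*conj[x]≈1 Nx≡1)
      NormOne-≉⇒cancellable _≟ᵠ_ 1≉0 {m = order ε} {{order≢0 χ}} (^order≈1 χ) elements-NormOne elements-distinct (order≤length χ) {n} {k}

  conj-^ : ∀ x n → conj (x ^ n) ≈ conj x ^ n
  conj-^ x zero    = conj-ι 1ℤ
  conj-^ x (suc n) = trans (conj-* x (x ^ n)) (*-congˡ (conj-^ x n))

  fromℤ≈ι : ∀ i → fromℤ i ≈ ι i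
  fromℤ≈ι i = trans (fromℤ-ι i) (ι-cong (fromℤ≡ₚ i))

  ι-injective : ∀ {a b} → ι a ≈ ι b → a ≡ₚ b
  ι-injective = re≈

  trace²-4≡D[2im]² : ∀ {β C} → NormOne β → β + conj β ≈ ι C → C ℤ.* C ℤ.- + 4 ≡ₚ D ℤ.* ((im β ℤ.+ im β) ℤ.* (im β ℤ.+ im β))
  trace²-4≡D[2im]² {β} {C} Nβ≡1 trace≈C = ℤₚ.trans (ℤₚ.+-cong (ℤₚ.*-cong C≡trace C≡trace) (ℤₚ.-‿cong (ℤₚ.*-congˡ {+ 4} (ℤₚ.sym Nβ≡1))))
                                                 (trace²-4norm β)
    where
      C≡trace : C ≡ₚ trace β
      C≡trace = ι-injective (trans (sym trace≈C) (+-conj β))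

  module _ {C β} (Nβ≡1 : NormOne β) (trace≈C : β + conj β ≈ ι C) where

    private
      r s : Quadratic
      r = 1# + β
      s = 1# + conj β

      β*conj[β]≈1 : β * conj β ≈ 1#
      β*conj[β]≈1 = NormOne⇒x*conj[x]≈1 Nβ≡1

      r+s≈C+2 : fromℤ (C ℤ.+ + 2) ≈ r + s
      r+s≈C+2 = begin⟨ setoid ⟩
        fromℤ (C ℤ.+ + 2)              ≈⟨ fromℤ-+ C (+ 2) ⟩
        fromℤ C + fromℤ (+ 2)          ≈⟨ +-congʳ (trans (fromℤ≈ι C) (sym trace≈C)) ⟩
        (β + conj β) + fromℤ (+ 2)     ≈⟨ solve 2 (λ b c → (b :+ c) :+ con (+ 2) := (con 1ℤ :+ b) :+ (con 1ℤ :+ c)) refl β (conj β) ⟩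
        r + s                          ∎

      r*s≈C+2 : fromℤ (C ℤ.+ + 2) ≈ r * s
      r*s≈C+2 = begin⟨ setoid ⟩
        fromℤ (C ℤ.+ + 2)              ≈⟨ r+s≈C+2 ⟩
        r + s                          ≈⟨ solve 2 (λ b c → (con 1ℤ :+ b) :+ (con 1ℤ :+ c) := con 1ℤ :+ (b :+ c) :+ con 1ℤ) refl β (conj β) ⟩
        1# + (β + conj β) + 1#         ≈⟨ +-congˡ β*conj[β]≈1 ⟨
        1# + (β + conj β) + β * conj β ≈⟨ solve 2 (λ b c → con 1ℤ :+ (b :+ c) :+ b :* c := (con 1ℤ :+ b) :* (con 1ℤ :+ c)) refl β (conj β) ⟩
        r * s                          ∎

      s≈r*conj[β] : s ≈ r * conj β
      s≈r*conj[β] = begin⟨ setoid ⟩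
        1# + conj β                    ≈⟨ +-congʳ β*conj[β]≈1 ⟨
        β * conj β + conj β            ≈⟨ solve 2 (λ b c → b :* c :+ c := (con 1ℤ :+ b) :* c) refl β (conj β) ⟩
        r * conj β                     ∎

      binet : ∀ k → (r - s) * fromℤ (U k (C ℤ.+ + 2) (C ℤ.+ + 2)) ≈ r ^ k - r ^ k * conj β ^ k
      binet k = trans (BinetFormulas.binet-U R[√D] r+s≈C+2 r*s≈C+2 k)
                      (+-congˡ (-‿cong (trans (^-congˡ k s≈r*conj[β]) (^-distrib-* r (conj β) k))))

    lucasU-vanishes⇔ : C ℤ.* C ℤ.- + 4 ≢ₚ 0ℤ → C ℤ.+ + 2 ≢ₚ 0ℤ → ∀ k →
                       U k (C ℤ.+ + 2) (C ℤ.+ + 2) ≡ₚ 0ℤ ⇔ β ^ k ≈ 1#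
    lucasU-vanishes⇔ C²-4≢0 C+2≢0 k = mk⇔ U≡0⇒β^k≈1 β^k≈1⇒U≡0
      where
        Uₖ = U k (C ℤ.+ + 2) (C ℤ.+ + 2)

        β^k≈1⇒U≡0 : β ^ k ≈ 1# → Uₖ ≡ₚ 0ℤ
        β^k≈1⇒U≡0 β^k≈1 = ι-injective (trans (sym (fromℤ≈ι Uₖ)) (r-s-cancellable (fromℤ Uₖ) (begin⟨ setoid ⟩
          fromℤ Uₖ * (r - s)              ≈⟨ *-comm _ _ ⟩
          (r - s) * fromℤ Uₖ              ≈⟨ binet k ⟩
          r ^ k - r ^ k * conj β ^ k      ≈⟨ +-congˡ (-‿cong (*-congˡ conj[β]^k≈1)) ⟩
          r ^ k - r ^ k * 1#              ≈⟨ solve 1 (λ x → x :- x :* con 1ℤ := con 0ℤ) refl (r ^ k) ⟩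
          0#                              ∎)))
          where
            conj[β]^k≈1 : conj β ^ k ≈ 1#
            conj[β]^k≈1 = trans (sym (conj-^ β k)) (trans (conj-cong β^k≈1) (conj-ι 1ℤ))
            r-s-cancellable : Cancellable (r - s)
            r-s-cancellable = Cancellable-resp-≈
              (solve 2 (λ b c → b :- c := (con 1ℤ :+ b) :- (con 1ℤ :+ c)) refl β (conj β))
              (norm-cancellable (≢ₚ0⇒cancellable isPrime norm≢0))
              where
                norm≢0 : norm (β - conj β) ≢ₚ 0ℤ
                norm≢0 norm≡0 = C²-4≢0 (begin⟨ ℤₚ.setoid ⟩
                  C ℤ.* C ℤ.- + 4                                 ≈⟨ trace²-4≡D[2im]² Nβ≡1 trace≈C ⟩
                  D ℤ.* ((im β ℤ.+ im β) ℤ.* (im β ℤ.+ im β))      ≈⟨ ≡⇒≡ₚ (ℤ.neg-involutive _) ⟨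
                  ℤ.- (ℤ.- (D ℤ.* ((im β ℤ.+ im β) ℤ.* (im β ℤ.+ im β)))) ≈⟨ ℤₚ.-‿cong (norm[x-conj[x]] β) ⟨
                  ℤ.- norm (β - conj β)                           ≈⟨ ℤₚ.-‿cong norm≡0 ⟩
                  0ℤ                                              ∎)

        U≡0⇒β^k≈1 : Uₖ ≡ₚ 0ℤ → β ^ k ≈ 1#
        U≡0⇒β^k≈1 U≡0 = begin⟨ setoid ⟩
          β ^ k                          ≈⟨ *-identityʳ _ ⟨
          β ^ k * 1#                     ≈⟨ *-congˡ conj[β]^k≈1 ⟨
          β ^ k * conj β ^ k             ≈⟨ ^-distrib-* β (conj β) k ⟨
          (β * conj β) ^ k               ≈⟨ x≈1⇒x^n≈1 k β*conj[β]≈1 ⟩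
          1#                             ∎
          where
            Z = 1# - conj β ^ k
            r^k*Z≈0 : r ^ k * Z ≈ 0#
            r^k*Z≈0 = begin⟨ setoid ⟩
              r ^ k * (1# - conj β ^ k)        ≈⟨ solve 2 (λ x y → x :* (con 1ℤ :- y) := x :- x :* y) refl (r ^ k) (conj β ^ k) ⟩
              r ^ k - r ^ k * conj β ^ k       ≈⟨ binet k ⟨
              (r - s) * fromℤ Uₖ               ≈⟨ *-congˡ (trans (fromℤ≈ι Uₖ) (ι-cong U≡0)) ⟩
              (r - s) * 0#                     ≈⟨ zeroʳ _ ⟩
              0#                               ∎
            Z≈0 : Z ≈ 0#
            Z≈0 = ι-cancellable (Cancellable-^ₚ (≢ₚ0⇒cancellable isPrime C+2≢0) k) Z (begin⟨ setoid ⟩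
              Z * ι ((C ℤ.+ + 2) ^ₚ k)          ≈⟨ *-congˡ (ι-^ (C ℤ.+ + 2) k) ⟨
              Z * ι (C ℤ.+ + 2) ^ k             ≈⟨ *-congˡ (^-congˡ k (trans (sym (fromℤ≈ι _)) r*s≈C+2)) ⟩
              Z * (r * s) ^ k                   ≈⟨ *-congˡ (^-distrib-* r s k) ⟩
              Z * (r ^ k * s ^ k)               ≈⟨ solve 3 (λ z a b → z :* (a :* b) := b :* (a :* z)) refl Z (r ^ k) (s ^ k) ⟩
              s ^ k * (r ^ k * Z)               ≈⟨ *-congˡ r^k*Z≈0 ⟩
              s ^ k * 0#                        ≈⟨ zeroʳ _ ⟩
              0#                                ∎)
            conj[β]^k≈1 : conj β ^ k ≈ 1#
            conj[β]^k≈1 = begin⟨ setoid ⟩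
              conj β ^ k                        ≈⟨ solve 1 (λ y → y := con 1ℤ :- (con 1ℤ :- y)) refl (conj β ^ k) ⟩
              1# - Z                            ≈⟨ +-congˡ (-‿cong Z≈0) ⟩
              1# - 0#                           ≈⟨ solve 0 (con 1ℤ :- con 0ℤ := con 1ℤ) refl ⟩
              1#                                ∎

  lucasV-NormOne : ∀ {α x} → NormOne α → α + conj α ≈ ι x → ∀ n → ι (V n x 1ℤ) ≈ α ^ n + conj (α ^ n)
  lucasV-NormOne {α} {x} Nα≡1 trace≈x n = begin⟨ setoid ⟩
    ι (V n x 1ℤ)                 ≈⟨ fromℤ≈ι (V n x 1ℤ) ⟨
    fromℤ (V n x 1ℤ)             ≈⟨ BinetFormulas.binet-V R[√D] (trans (fromℤ≈ι x) (sym trace≈x))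
                                                                (trans (fromℤ≈ι 1ℤ) (sym (NormOne⇒x*conj[x]≈1 Nα≡1))) n ⟩
    α ^ n + conj α ^ n           ≈⟨ +-congˡ (conj-^ α n) ⟨
    α ^ n + conj (α ^ n)         ∎

  private
    half : ℤ
    half = + suc h

    2*half≡1 : + 2 ℤ.* half ≡ₚ 1ℤ
    2*half≡1 = ℤₚ.sym (difference≡ₚ0⇒≡ₚ (ℤₚ.trans (≡⇒≡ₚ (≡.trans (1-2[1+h]≡-[1+2h] (+ h)) (≡.cong (λ q → ℤ.- (+ q)) (≡.sym p≡1+2h))))
                                                   (ℤₚ.trans (ℤₚ.-‿cong p≡ₚ0) (≡⇒≡ₚ ≡.refl))))
      where
        1-2[1+h]≡-[1+2h] : ∀ x → 1ℤ ℤ.- + 2 ℤ.* (1ℤ ℤ.+ x) ≡ ℤ.- (1ℤ ℤ.+ (x ℤ.+ x))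
        1-2[1+h]≡-[1+2h] = solve-∀

  -- (c + √D)/2; h + 1 represents 1/2 since 2(h + 1) = p + 1.
  half-trace : ℤ → Quadratic
  half-trace c = c ℤ.* half +√D· half

  module _ {c} (D≡c²-4 : D ≡ c ℤ.* c ℤ.- + 4) where

    half-trace-NormOne : NormOne (half-trace c)
    half-trace-NormOne = ℤₚ.trans (≡⇒≡ₚ (≡.trans (≡.cong (λ d → (c ℤ.* half) ℤ.* (c ℤ.* half) ℤ.- d ℤ.* (half ℤ.* half)) D≡c²-4)
                                                 (norm≡[2half]² c half)))
                                  (ℤₚ.*-cong 2*half≡1 2*half≡1)
      where
        norm≡[2half]² : ∀ c x → (c ℤ.* x) ℤ.* (c ℤ.* x) ℤ.- (c ℤ.* c ℤ.- + 4) ℤ.* (x ℤ.* x) ≡ (+ 2 ℤ.* x) ℤ.* (+ 2 ℤ.* x)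
        norm≡[2half]² = solve-∀

    half-trace-trace : half-trace c + conj (half-trace c) ≈ ι c
    half-trace-trace = trans (+-conj (half-trace c)) (ι-cong (ℤₚ.trans (≡⇒≡ₚ (twice c half))
                                                                       (ℤₚ.trans (ℤₚ.*-congˡ {c} 2*half≡1) (≡⇒≡ₚ (ℤ.*-identityʳ c)))))
      where
        twice : ∀ c x → c ℤ.* x ℤ.+ c ℤ.* x ≡ c ℤ.* (+ 2 ℤ.* x)
        twice = solve-∀

module SolvabilityCriterion {p h} (isPrime : Prime p) (p≡1+2h : p ≡ suc (h ℕ.+ h)) {C : ℤ} where

  open IntegersModulo p
  open import Data.Product using (_×_)
  open import Relation.Binary.Reasoning.MultiSetoid

  module _ (D≢0 : (C ℤ.* C ℤ.- + 4) ≢ₚ 0ℤ) (C+2≢0 : C ℤ.+ + 2 ≢ₚ 0ℤ) {n k : ℕ}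
           (kd≡m : k ℕ.* gcd n ℤ.∣ + p ℤ.- legendre (C ℤ.* C ℤ.- + 4) p ∣ ≡ ℤ.∣ + p ℤ.- legendre (C ℤ.* C ℤ.- + 4) p ∣) where

    private
      module E = QuadraticExtensionModulo {h = h} isPrime p≡1+2h (C ℤ.* C ℤ.- + 4)

      χ : E.QuadraticCharacter (legendre (C ℤ.* C ℤ.- + 4) p)
      χ = E.euler-criterion D≢0

    lucasU-vanishes⇒solvable : U k (C ℤ.+ + 2) (C ℤ.+ + 2) ≡ₚ 0ℤ → ∃[ x ] V n x 1ℤ ≡ₚ C
    lucasU-vanishes⇒solvable Uₖ≡0 = trace α , ι-injective (begin⟨ setoid ⟩
      ι (V n (trace α) 1ℤ)         ≈⟨ lucasV-NormOne Nα≡1 (+-conj α) n ⟩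
      α ^ n + conj (α ^ n)          ≈⟨ +-cong αⁿ≈β (conj-cong αⁿ≈β) ⟩
      β + conj β                    ≈⟨ trace[β]≈C ⟩
      ι C                           ∎)
      where
        open E
        open CommutativeRing R[√D]
        open ExpAndCancellation R[√D] using (_^_)
        β : Quadratic
        β = half-trace C
        Nβ≡1 : NormOne β
        Nβ≡1 = half-trace-NormOne {c = C} ≡.refl
        trace[β]≈C : β + conj β ≈ ι C
        trace[β]≈C = half-trace-trace {c = C} ≡.refl
        βᵏ≈1 : β ^ k ≈ 1#
        βᵏ≈1 = Equivalence.to (lucasU-vanishes⇔ Nβ≡1 trace[β]≈C D≢0 C+2≢0 k) Uₖ≡0
        root : ∃[ α ] (NormOne α × α ^ n ≈ β)
        root = Equivalence.from (NormOneGroup.nth-power⇔ D≢0 χ {n} {k} kd≡m Nβ≡1) βᵏ≈1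
        α = proj₁ root
        Nα≡1 = proj₁ (proj₂ root)
        αⁿ≈β = proj₂ (proj₂ root)

    solvable⇒lucasU-vanishes : ∀ {x} → V n x 1ℤ ≡ₚ C → U k (C ℤ.+ + 2) (C ℤ.+ + 2) ≡ₚ 0ℤ
    solvable⇒lucasU-vanishes {x} Vₙ≡C = Equivalence.from (lucasU-vanishes⇔ Nβ≡1 trace[β]≈C D≢0 C+2≢0 k) βᵏ≈1
      where
        D′ : ℤ
        D′ = x ℤ.* x ℤ.- + 4
        module Pₚ = ExpAndCancellation ℤₚ
        open QuadraticExtensionModulo {h = h} isPrime p≡1+2h D′
        open CommutativeRing R[√D]
        open ExpAndCancellation R[√D] using (_^_)
        α : Quadratic
        α = half-trace x
        Nα≡1 : NormOne α
        Nα≡1 = half-trace-NormOne {c = x} ≡.refl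
        β : Quadratic
        β = α ^ n
        Nβ≡1 : NormOne β
        Nβ≡1 = NormOne-^ Nα≡1 n
        trace[β]≈C : β + conj β ≈ ι C
        trace[β]≈C = trans (sym (lucasV-NormOne Nα≡1 (half-trace-trace {c = x} ≡.refl) n)) (ι-cong Vₙ≡C)
        e : ℤ
        e = im β ℤ.+ im β
        D≡D′e² : (C ℤ.* C ℤ.- + 4) ≡ₚ D′ ℤ.* (e ℤ.* e)
        D≡D′e² = trace²-4≡D[2im]² Nβ≡1 trace[β]≈C
        e≢0 : e ≢ₚ 0ℤ
        e≢0 e≡0 = D≢0 (ℤₚ.trans D≡D′e² (ℤₚ.trans (ℤₚ.*-congˡ {D′} (ℤₚ.*-cong e≡0 e≡0)) (≡⇒≡ₚ (ℤ.*-zeroʳ D′))))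
        D′≢0 : D′ ≢ₚ 0ℤ
        D′≢0 D′≡0 = D≢0 (ℤₚ.trans D≡D′e² (ℤₚ.trans (ℤₚ.*-congʳ D′≡0) (ℤₚ.zeroˡ (e ℤ.* e))))
        D′ʰ≡Dʰ : D′ Pₚ.^ h ≡ₚ (C ℤ.* C ℤ.- + 4) Pₚ.^ h
        D′ʰ≡Dʰ = ℤₚ.sym (ℤₚ.trans (Pₚ.^-congˡ h D≡D′e²) (half-power-invariant isPrime {h} p≡1+2h {a = D′} e≢0))
        transfer : ∀ {ε} → E.QuadraticCharacter ε → QuadraticCharacter ε
        transfer (E.residue Dʰ≡1)     = residue (ℤₚ.trans D′ʰ≡Dʰ Dʰ≡1)
        transfer (E.nonresidue Dʰ≡-1) = nonresidue (ℤₚ.trans D′ʰ≡Dʰ Dʰ≡-1)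
        βᵏ≈1 : β ^ k ≈ 1#
        βᵏ≈1 = Equivalence.to (NormOneGroup.nth-power⇔ D′≢0 (transfer χ) {n} {k} kd≡m Nβ≡1) (α , Nα≡1 , refl)

-- The integer operations are opened unqualified only here: the modules above open ring operations of the same names.
open import Defs
open import Data.Nat as ℕ using (ℕ)
open import Data.Nat.GCD using (gcd)
open import Data.Nat.Primality using (Prime)
open import Data.Integer using (ℤ; +_; _+_; _-_; _*_; ∣_∣; 1ℤ)
open import Data.Integer.Divisibility.Signed using (_∣_)
open import Data.Product using (∃)
open import Function.Bundles using (_⇔_)
open import Relation.Binary.PropositionalEquality using (_≡_; _≢_)
open import Relation.Nullary using (¬_)

theorem1p3 : (n p : ℕ) (C : ℤ) → Prime p → p ≢ 2 →
  ¬ (+ p ∣ C * (C * C - + 4)) →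
  let ε = legendre (C * C - + 4) p
      d = gcd n ∣ + p - ε ∣
  in (k : ℕ) → k ℕ.* d ≡ ∣ + p - ε ∣ →
     (∃ λ (x : ℤ) → + p ∣ V n x 1ℤ - C) ⇔ (+ p ∣ U k (C + + 2) (C + + 2))
theorem1p3 n p C isPrime p≢2 p∤C[C²-4] k kd≡m = mk⇔
  (λ (x , p∣Vₙ-C) → ≡ₚ0⇒∣ (solvable⇒lucasU-vanishes D≢0 C+2≢0 {n} {k} kd≡m {x} (∣⇒≡ₚ p∣Vₙ-C)))
  (λ p∣Uₖ → Product.map₂ ≡ₚ⇒∣ (lucasU-vanishes⇒solvable D≢0 C+2≢0 {n} {k} kd≡m (∣⇒≡ₚ0 p∣Uₖ)))
  where
    open IntegersModulo p
    p-odd = prime≢2⇒odd isPrime p≢2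
    open SolvabilityCriterion {h = proj₁ p-odd} isPrime (proj₂ p-odd) {C}
    factorisation : ∀ c → c * (c - + 2) * (c + + 2) ≡ c * (c * c - + 4)
    factorisation = solve-∀
    D≢0 : C * C - + 4 ≢ₚ 0ℤ
    D≢0 = p∤C[C²-4] ∘ ℤ.∣n⇒∣m*n C ∘ ≡ₚ0⇒∣
    C+2≢0 : C + + 2 ≢ₚ 0ℤ
    C+2≢0 = p∤C[C²-4] ∘ ≡.subst (+ p ∣_) (factorisation C) ∘ ℤ.∣n⇒∣m*n (C * (C - + 2)) ∘ ≡ₚ0⇒∣
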